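{- Let $S=\{n_1,n_2,\ldots,n_s\}$ be a set of integers with $2\le n_s<\cdots<n_2<n_1$, and suppose $n_1-1\notin S$ and $n_s+1\in S$ (so $n_{s-1}=n_s+1$ and $s\ge3$). Let $T=(m_1,\ldots,m_{s-1})=(n_1,\ldots,n_{s-2},n_s)$ and let $\mathcal H^{\star1}_{n_1,\ldots,n_s}$ be the mixed hypergraph obtained from $\mathcal H^{\star}_{T}=(X_T,\mathcal C^{\star}_T,\mathcal D_T)$ by deleting the $\mathcal C$-edge $e_2=\{(n_s,\ldots,n_s,1),(n_s,\ldots,n_s,n_s),(1,\ldots,1,1)\}$ (these are $(s-1)$-tuples; in the first, $n_s$ is repeated $s-2$ times). Then $\mathcal H^{\star1}_{n_1,\ldots,n_s}$ is a one-realization of $S$.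
   Context: A mixed hypergraph is a triple $\mathcal H=(X,\mathcal C,\mathcal D)$ where $X$ is a finite set and $\mathcal C,\mathcal D$ are families of subsets of $X$ ($\mathcal C$-edges and $\mathcal D$-edges). A proper $k$-coloring is a map from $X$ to a set of $k$ colors such that every $\mathcal C$-edge contains two vertices of a common color and every $\mathcal D$-edge contains two vertices of distinct colors; it is strict if all $k$ colors are used. Colorings are identified with partitions of $X$ into color classes. The feasible set is the set of $k$ for which a strict $k$-coloring exists; $r_k$ is the number of partitions arising as strict $k$-colorings. $\mathcal H$ is a one-realization of $S$ if its feasible set is $S$ and $r_k=1$ for all $k\in S$. Construction, for any integers $m_1>m_2>\cdots>m_r\ge2$ with $T=(m_1,\ldots,m_r)$: vertices are $r$-tuples of integers; $[m]=\{1,\ldots,m\}$. For $t\in\{2,\ldots,r\}$ and integer $j$, let $u_t(j)=(j,\ldots,j,m_t,m_{t+1},\ldots,m_r)$ and $v_t(j)=(j,\ldots,j,1,\ldots,1)$, with $j$ repeated $t-1$ times in both. Then $X_T=\{(m_1,\ldots,m_r)\}\cup\{(i,\ldots,i): i\in[m_r-1]\}\cup\{u_t(j),v_t(j): 2\le t\le r,\ m_t\le j\le m_{t-1}-1\}$; $\mathcal D_T$ = all pairs $\{(x_1,\ldots,x_r),(y_1,\ldots,y_r)\}$ of elements of $X_T$ with $x_i\ne y_i$ for every $i\in[r]$; $\mathcal C^{\star}_T$ consists of, for each $t\in\{2,\ldots,r\}$: the triples $\{u_t(j),v_t(j),v_t(j-1)\}$ for $m_t+1\le j\le m_{t-1}-1$;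 the triples $\{v_t(j),u_t(j),u_t(j+1)\}$ for $m_t\le j\le m_{t-1}-1$; and the triple $\{u_t(m_t),v_t(m_t),(1,\ldots,1)\}$. $\mathcal H^{\star}_T=(X_T,\mathcal C^{\star}_T,\mathcal D_T)$. Here this is applied with $r=s-1$ and $T=(n_1,\ldots,n_{s-2},n_s)$, and $e_2$ is the triple $\{v_{s-1}(n_s),u_{s-1}(n_s),(1,\ldots,1)\}$ of $\mathcal C^{\star}_T$. -}

module Defs where

open import Data.Nat using (ℕ; zero; suc; _+_; _∸_; _≤_; _<_; _<?_; _≤?_)
open import Data.Fin using (Fin; toℕ)
open import Data.Vec using (Vec; tabulate; lookup; replicate)
open import Data.List using (List; []; _∷_; map; concatMap; upTo; _++_)
open import Data.List.Membership.Propositional using (_∈_)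
open import Data.Product using (Σ; ∃; ∃-syntax; _×_; _,_)
open import Data.Bool using (if_then_else_)
open import Relation.Nullary using (¬_)
open import Relation.Nullary.Decidable using (⌊_⌋)
open import Relation.Binary.PropositionalEquality using (_≡_)
open import Function.Bundles using (_⇔_)

-- Edges are given as lists of vertices (read as the sets of their
-- elements); the edge families 𝒞, 𝒟 are predicates on such lists.
record MixedHypergraph (V : Set) : Set₁ where
  field
    X : List V
    𝒞 : List V → Set
    𝒟 : List V → Set
open MixedHypergraph public

module _ {V : Set} (H : MixedHypergraph V) where

  -- a coloring with k colors (only its values on X matter)
  Proper : {k : ℕ} → (V → Fin k) → Set
  Proper c =
    (∀ e → 𝒞 H e → ∃[ x ] ∃[ y ] (x ∈ e × y ∈ e × ¬ (x ≡ y) × c x ≡ c y)) ×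
    (∀ e → 𝒟 H e → ∃[ x ] ∃[ y ] (x ∈ e × y ∈ e × ¬ (c x ≡ c y)))

  UsesAll : {k : ℕ} → (V → Fin k) → Set
  UsesAll {k} c = ∀ (i : Fin k) → ∃[ x ] (x ∈ X H × c x ≡ i)

  StrictColoring : (k : ℕ) → (V → Fin k) → Set
  StrictColoring k c = Proper c × UsesAll c

  Feasible : ℕ → Set
  Feasible k = ∃[ c ] StrictColoring k c

  SamePartition : {k : ℕ} → (V → Fin k) → (V → Fin k) → Set
  SamePartition c c' = ∀ x y → x ∈ X H → y ∈ X H → (c x ≡ c y ⇔ c' x ≡ c' y)

  rIsOne : ℕ → Set
  rIsOne k = Feasible k ×
    (∀ c c' → StrictColoring k c → StrictColoring k c' → SamePartition c c')

  OneRealization : (ℕ → Set) → Set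
  OneRealization S = (∀ k → Feasible k ⇔ S k) × (∀ k → S k → rIsOne k)

-- The construction H⋆_T, with T = (m 1, …, m r) (1-based index function)

range : ℕ → ℕ → List ℕ
range a b = map (a +_) (upTo (b ∸ a))

module Construction (r : ℕ) (m : ℕ → ℕ) where

  V : Set
  V = Vec ℕ r

  -- 1-based position of a coordinate
  pos : Fin r → ℕ
  pos i = suc (toℕ i)

  top : V
  top = tabulate (λ i → m (pos i))

  diag : ℕ → V
  diag i = replicate r i

  ones : V
  ones = replicate r 1

  -- u_t(j) = (j,…,j, m_t, …, m_r), v_t(j) = (j,…,j,1,…,1), j repeated t-1 times
  u : ℕ → ℕ → V
  u t j = tabulate (λ i → if ⌊ pos i <? t ⌋ then j else m (pos i))

  v : ℕ → ℕ → V
  v t j = tabulate (λ i → if ⌊ pos i <? t ⌋ then j else 1)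

  XT : List V
  XT = top ∷ (map diag (range 1 (m r)) ++
        concatMap (λ t → concatMap (λ j → u t j ∷ v t j ∷ [])
                                   (range (m t) (m (t ∸ 1))))
                  (range 2 (suc r)))

  DT : List V → Set
  DT e = ∃[ x ] ∃[ y ] (x ∈ XT × y ∈ XT × e ≡ x ∷ y ∷ [] ×
           (∀ (i : Fin r) → ¬ (lookup x i ≡ lookup y i)))

  data CStar : List V → Set where
    c₁ : ∀ t j → 2 ≤ t → t ≤ r → m t + 1 ≤ j → j ≤ m (t ∸ 1) ∸ 1 →
         CStar (u t j ∷ v t j ∷ v t (j ∸ 1) ∷ [])
    c₂ : ∀ t j → 2 ≤ t → t ≤ r → m t ≤ j → j ≤ m (t ∸ 1) ∸ 1 →
         CStar (v t j ∷ u t j ∷ u t (j + 1) ∷ [])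
    c₃ : ∀ t → 2 ≤ t → t ≤ r →
         CStar (u t (m t) ∷ v t (m t) ∷ ones ∷ [])

  HStar : MixedHypergraph V
  HStar = record { X = XT ; 𝒞 = CStar ; 𝒟 = DT }

  SameSet : List V → List V → Set
  SameSet e f = ∀ x → (x ∈ e ⇔ x ∈ f)

  e₂ : List V
  e₂ = v r (m r) ∷ u r (m r) ∷ ones ∷ []

  HStar1 : MixedHypergraph V
  HStar1 = record { X = XT ; 𝒞 = λ e → CStar e × ¬ SameSet e e₂ ; 𝒟 = DT }

InS : (s : ℕ) → (ℕ → ℕ) → ℕ → Set
InS s n k = ∃[ i ] (1 ≤ i × i ≤ s × n i ≡ k)

Tseq : (s : ℕ) → (ℕ → ℕ) → ℕ → ℕ
Tseq s n p = if ⌊ p ≤? s ∸ 2 ⌋ then n p else n s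

H⋆¹ : (s : ℕ) → (ℕ → ℕ) → MixedHypergraph (Vec ℕ (s ∸ 1))
H⋆¹ s n = Construction.HStar1 (s ∸ 1) (Tseq s n)

module Submission where

open import Defs
open import Data.Nat using (ℕ; zero; suc; >-nonZero; _+_; _∸_; _≤_; _<_; z≤n; s≤s; _<?_; _≤?_; _⊓_; _≟_)
open import Data.Nat.Properties
open import Data.Fin as F using (Fin; toℕ; fromℕ<)
import Data.Fin.Properties as FP
open import Data.Vec using (tabulate; lookup)
open import Data.Vec.Properties using (lookup∘tabulate; tabulate-cong; lookup-replicate)
open import Data.List using (List; []; _∷_; map; concatMap)
open import Data.List.Membership.Propositional using (_∈_; find; lose)
open import Data.List.Membership.Propositional.Properties
open import Data.List.Relation.Unary.Any using (here; there)
open import Data.Product using (Σ; ∃; ∃-syntax; _×_; _,_; proj₁; proj₂; curry)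
open import Data.Sum using (_⊎_; inj₁; inj₂; fromInj₂)
open import Data.Bool using (if_then_else_)
open import Data.Empty
open import Data.Unit using (⊤; tt)
open import Relation.Nullary
open import Relation.Nullary.Decidable using (⌊_⌋)
open import Relation.Binary.PropositionalEquality
open import Relation.Binary.Definitions using (tri<; tri≈; tri>)
open import Function.Bundles using (_⇔_; mk⇔; Equivalence)
import Function.Properties.Equivalence as ⇔

-- A proper colouring of H⋆¹ is determined, up to its partition, by the set of j for which
-- u_t(j) and v_t(j) share a colour ("j is merged") and by whether v_r(m_r) shares a colour
-- with (1,…,1); the 𝒟-edges separate everything else. The 𝒞-edges force the merged j to
-- form an initial segment [m_r, m_t), and then the partition has m_t classes, unless t = r
-- and v_r(m_r) is not joined to (1,…,1), when it has m_r + 1 classes; this last case is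
-- possible only because e₂ is deleted. Colouring by the t-th coordinate, and a variant of
-- the last-coordinate colouring, realise every case, and distinct cases have distinct
-- numbers of colours, so each feasible k has a unique partition. With
-- T = (n_1, …, n_{s-2}, n_s) and n_{s-1} = n_s + 1 the feasible set is S; the hypothesis
-- n_1 - 1 ∉ S only excludes s = 2.

∈-range⁺ : ∀ {a b i} → a ≤ i → i < b → i ∈ range a b
∈-range⁺ {a} {b} {i} a≤i i<b =
  subst (_∈ range a b) (m+[n∸m]≡n a≤i) (∈-map⁺ (a +_) (∈-upTo⁺ (∸-monoˡ-< i<b a≤i)))

∈-range⁻ : ∀ {a b i} → i ∈ range a b → a ≤ i × i < b
∈-range⁻ {a} {b} {i} p with ∈-map⁻ (a +_) p
... | x , x∈ , refl = m≤m+n a x , lt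
  where
  x< : x < b ∸ a
  x< = ∈-upTo⁻ x∈
  a≤b : a ≤ b
  a≤b = <⇒≤ (m∸n≢0⇒n<m (m<n⇒n≢0 x<))
  lt : a + x < b
  lt = subst (a + x <_) (m+[n∸m]≡n a≤b) (+-monoʳ-< a x<)

if-true : ∀ {A : Set} {P : Set} (d : Dec P) {a b : A} → P → (if ⌊ d ⌋ then a else b) ≡ a
if-true (yes _) _ = refl
if-true (no ¬p) p = ⊥-elim (¬p p)

if-false : ∀ {A : Set} {P : Set} (d : Dec P) {a b : A} → ¬ P → (if ⌊ d ⌋ then a else b) ≡ b
if-false (yes p) ¬p = ⊥-elim (¬p p)
if-false (no _) _ = refl

clamp : (n : ℕ) → ℕ → Fin (suc n)
clamp zero _ = F.zero
clamp (suc n) zero = F.zero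
clamp (suc n) (suc i) = F.suc (clamp n i)

toℕ-clamp : ∀ n i → i ≤ n → toℕ (clamp n i) ≡ i
toℕ-clamp zero zero _ = refl
toℕ-clamp (suc n) zero _ = refl
toℕ-clamp (suc n) (suc i) (s≤s le) = cong suc (toℕ-clamp n i le)

clamp-injective : ∀ {n i i'} → i ≤ n → i' ≤ n → clamp n i ≡ clamp n i' → i ≡ i'
clamp-injective {n} {i} {i'} le le' eq =
  trans (sym (toℕ-clamp n i le)) (trans (cong toℕ eq) (toℕ-clamp n i' le'))

clamp-toℕ : ∀ n (i : Fin (suc n)) → clamp n (toℕ i) ≡ i
clamp-toℕ zero F.zero = refl
clamp-toℕ (suc n) F.zero = refl
clamp-toℕ (suc n) (F.suc i) = cong F.suc (clamp-toℕ n i)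

module Decreasing (f : ℕ → ℕ) (R : ℕ) (step : ∀ p → 1 ≤ p → p < R → f (suc p) < f p) where
  decreasing-< : ∀ {p} q → 1 ≤ p → p < q → q ≤ R → f q < f p
  decreasing-< {p} (suc q) 1≤p p<q q≤R with m≤n⇒m<n∨m≡n (≤-pred p<q)
  ... | inj₂ refl = step p 1≤p q≤R
  ... | inj₁ p<q' = <-trans (step q (≤-trans 1≤p (<⇒≤ p<q')) q≤R) (decreasing-< q 1≤p p<q' (<⇒≤ q≤R))

  decreasing-≤ : ∀ {p} q → 1 ≤ p → p ≤ q → q ≤ R → f q ≤ f p
  decreasing-≤ {p} q 1≤p p≤q q≤R with m≤n⇒m<n∨m≡n p≤q
  ... | inj₂ refl = ≤-refl
  ... | inj₁ p<q = <⇒≤ (decreasing-< q 1≤p p<q q≤R)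

  decreasing-injective : ∀ {p q} → 1 ≤ p → 1 ≤ q → p ≤ R → q ≤ R → f p ≡ f q → p ≡ q
  decreasing-injective {p} {q} 1p 1q pR qR eq with <-cmp p q
  ... | tri≈ _ e _ = e
  ... | tri< lt _ _ = ⊥-elim (<⇒≢ (decreasing-< q 1p lt qR) (sym eq))
  ... | tri> _ _ gt = ⊥-elim (<⇒≢ (decreasing-< p 1q gt pR) eq)

drop-middle : ∀ {A B C : Set} → ¬ B → A ⊎ B ⊎ C → A ⊎ C
drop-middle ¬b (inj₁ a) = inj₁ a
drop-middle ¬b (inj₂ (inj₁ b)) = ⊥-elim (¬b b)
drop-middle ¬b (inj₂ (inj₂ c)) = inj₂ c

firstCounterexample : (P : ℕ → Set) → (∀ j → Dec (P j)) → ∀ lo hi →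
         (∀ j → lo ≤ j → j < hi → P j) ⊎
         (∃ λ a → lo ≤ a × a < hi × ¬ P a × (∀ j → lo ≤ j → j < a → P j))
firstCounterexample P P? lo zero = inj₁ (λ j _ ())
firstCounterexample P P? lo (suc h) with firstCounterexample P P? lo h
... | inj₂ (a , lo≤a , a<h , ¬Pa , below) = inj₂ (a , lo≤a , <-trans a<h (n<1+n h) , ¬Pa , below)
... | inj₁ all with lo ≤? h
...   | no lo≰h = inj₁ (λ j lo≤j j≤h → ⊥-elim (lo≰h (≤-trans lo≤j (≤-pred j≤h))))
...   | yes lo≤h with P? h
...     | no ¬Ph = inj₂ (h , lo≤h , n<1+n h , ¬Ph , all)
...     | yes Ph = inj₁ all′
  where
  all′ : ∀ j → lo ≤ j → j < suc h → P j
  all′ j lo≤j j≤h with m≤n⇒m<n∨m≡n (≤-pred j≤h)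
  ... | inj₁ j<h = all j lo≤j j<h
  ... | inj₂ refl = Ph

module _ {V : Set} (H : MixedHypergraph V) where

  usesAll-refines⇒≤ : ∀ {k N} (c : V → Fin k) (ψ : V → Fin N) → UsesAll H c →
                      (∀ x y → x ∈ X H → y ∈ X H → ψ x ≡ ψ y → c x ≡ c y) → k ≤ N
  usesAll-refines⇒≤ {k} {N} c ψ usesAll ψ⇒c = FP.injective⇒≤ ψ∘rep-injective
    where
    ψ∘rep : Fin k → Fin N
    ψ∘rep i = ψ (proj₁ (usesAll i))
    ψ∘rep-injective : ∀ {i i'} → ψ∘rep i ≡ ψ∘rep i' → i ≡ i'
    ψ∘rep-injective {i} {i'} eq with usesAll i | usesAll i'
    ... | x , x∈X , refl | y , y∈X , refl = ψ⇒c x y x∈X y∈X eq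

  colours-unique : ∀ {k N} (c : V → Fin k) (ψ : V → Fin N) → UsesAll H c → UsesAll H ψ →
                   (∀ x y → x ∈ X H → y ∈ X H → c x ≡ c y → ψ x ≡ ψ y) →
                   (∀ x y → x ∈ X H → y ∈ X H → ψ x ≡ ψ y → c x ≡ c y) → k ≡ N
  colours-unique c ψ usesAll-c usesAll-ψ c⇒ψ ψ⇒c =
    ≤-antisym (usesAll-refines⇒≤ c ψ usesAll-c ψ⇒c) (usesAll-refines⇒≤ ψ c usesAll-ψ c⇒ψ)

  OneRealization-resp : ∀ {S S' : ℕ → Set} → (∀ k → S k ⇔ S' k) →
                        OneRealization H S → OneRealization H S'
  OneRealization-resp S⇔S' (feasible⇔S , S⇒rIsOne) =
    (λ k → ⇔.trans (feasible⇔S k) (S⇔S' k)) ,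
    (λ k s' → S⇒rIsOne k (Equivalence.from (S⇔S' k) s'))

module StarOne (r' : ℕ) (m : ℕ → ℕ)
  (m-decreasing : ∀ p → 1 ≤ p → p < suc (suc r') → m (suc p) < m p)
  (2≤mr : 2 ≤ m (suc (suc r')))
  (mr+1<m[r-1] : suc (m (suc (suc r'))) < m (suc r')) where

  r : ℕ
  r = suc (suc r')

  open Construction r m
  open Decreasing m r m-decreasing

  mr<m1 : m r < m 1
  mr<m1 = decreasing-< r (s≤s z≤n) (s≤s (s≤s z≤n)) ≤-refl

  mr≤m : ∀ p → 1 ≤ p → p ≤ r → m r ≤ m p
  mr≤m p 1p pr = decreasing-≤ r 1p pr ≤-refl

  m≤m1 : ∀ p → 1 ≤ p → p ≤ r → m p ≤ m 1
  m≤m1 p 1p pr = decreasing-≤ p (s≤s z≤n) 1p pr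

  pos≥1 : ∀ i → 1 ≤ pos i
  pos≥1 i = s≤s z≤n

  pos≤r : ∀ i → pos i ≤ r
  pos≤r i = FP.toℕ<n i

  mr≤m-pos : ∀ i → m r ≤ m (pos i)
  mr≤m-pos i = mr≤m (pos i) (pos≥1 i) (pos≤r i)

  m-pos≤m1 : ∀ i → m (pos i) ≤ m 1
  m-pos≤m1 i = m≤m1 (pos i) (pos≥1 i) (pos≤r i)

  2≤m-pos : ∀ i → 2 ≤ m (pos i)
  2≤m-pos i = ≤-trans 2≤mr (mr≤m-pos i)

  2≤⇒1≤ : ∀ {t} → 2 ≤ t → 1 ≤ t
  2≤⇒1≤ 2t = ≤-trans (s≤s z≤n) 2t

  1≤t∸1 : ∀ t → 2 ≤ t → 1 ≤ t ∸ 1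
  1≤t∸1 (suc (suc t)) _ = s≤s z≤n
  1≤t∸1 (suc zero) (s≤s ())

  m-t∸1≤m1 : ∀ t → 2 ≤ t → t ≤ r → m (t ∸ 1) ≤ m 1
  m-t∸1≤m1 t 2t tr = m≤m1 (t ∸ 1) (1≤t∸1 t 2t) (≤-trans (m∸n≤m t 1) tr)

  level-lower : ∀ {t j} → 2 ≤ t → t ≤ r → m t ≤ j → m r ≤ j
  level-lower {t} 2t tr lo = ≤-trans (mr≤m t (2≤⇒1≤ 2t) tr) lo

  level-upper : ∀ {t j} → 2 ≤ t → t ≤ r → j < m (t ∸ 1) → j < m 1
  level-upper {t} 2t tr hi = <-≤-trans hi (m-t∸1≤m1 t 2t tr)

  -- For m_t ≤ j < m_{t-1} the vertices u_t(j), v_t(j) depend only on j (u≡Uℓ, v≡Vℓ).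
  Uℓ : ℕ → V
  Uℓ j = tabulate (λ i → j ⊓ m (pos i))

  Vℓ : ℕ → V
  Vℓ j = tabulate (λ i → if ⌊ j <? m (pos i) ⌋ then j else 1)

  lookup-Uℓ : ∀ j i → lookup (Uℓ j) i ≡ j ⊓ m (pos i)
  lookup-Uℓ j i = lookup∘tabulate (λ i → j ⊓ m (pos i)) i

  lookup-Vℓ-< : ∀ j i → j < m (pos i) → lookup (Vℓ j) i ≡ j
  lookup-Vℓ-< j i lt = trans (lookup∘tabulate (λ i → if ⌊ j <? m (pos i) ⌋ then j else 1) i)
    (if-true (j <? m (pos i)) lt)

  lookup-Vℓ-≥ : ∀ j i → m (pos i) ≤ j → lookup (Vℓ j) i ≡ 1
  lookup-Vℓ-≥ j i le = trans (lookup∘tabulate (λ i → if ⌊ j <? m (pos i) ⌋ then j else 1) i)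
    (if-false (j <? m (pos i)) (≤⇒≯ le))

  lookup-ones : ∀ i → lookup ones i ≡ 1
  lookup-ones i = lookup-replicate i 1

  lookup-diag : ∀ a i → lookup (diag a) i ≡ a
  lookup-diag a i = lookup-replicate i a

  lookup-u-< : ∀ t j i → pos i < t → lookup (u t j) i ≡ j
  lookup-u-< t j i lt = trans (lookup∘tabulate (λ i → if ⌊ pos i <? t ⌋ then j else m (pos i)) i)
    (if-true (pos i <? t) lt)

  lookup-u-≥ : ∀ t j i → t ≤ pos i → lookup (u t j) i ≡ m (pos i)
  lookup-u-≥ t j i le = trans (lookup∘tabulate (λ i → if ⌊ pos i <? t ⌋ then j else m (pos i)) i)
    (if-false (pos i <? t) (≤⇒≯ le))

  lookup-v-< : ∀ t j i → pos i < t → lookup (v t j) i ≡ j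
  lookup-v-< t j i lt = trans (lookup∘tabulate (λ i → if ⌊ pos i <? t ⌋ then j else 1) i)
    (if-true (pos i <? t) lt)

  lookup-v-≥ : ∀ t j i → t ≤ pos i → lookup (v t j) i ≡ 1
  lookup-v-≥ t j i le = trans (lookup∘tabulate (λ i → if ⌊ pos i <? t ⌋ then j else 1) i)
    (if-false (pos i <? t) (≤⇒≯ le))

  m-below : ∀ t j i → t ≤ r → j ≤ m (t ∸ 1) → pos i < t → j ≤ m (pos i)
  m-below (suc t) j i tr jle (s≤s pi≤t) = ≤-trans jle (decreasing-≤ t (pos≥1 i) pi≤t (≤-trans (n≤1+n t) tr))

  m-above : ∀ t j i → m t ≤ j → t ≤ pos i → 1 ≤ t → m (pos i) ≤ j
  m-above t j i le tp 1t = ≤-trans (decreasing-≤ (pos i) 1t tp (pos≤r i)) le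

  u≡Uℓ : ∀ t j → 1 ≤ t → t ≤ r → m t ≤ j → j ≤ m (t ∸ 1) → u t j ≡ Uℓ j
  u≡Uℓ t j 1t tr lo hi = tabulate-cong pointwise
    where
    pointwise : ∀ i → (if ⌊ pos i <? t ⌋ then j else m (pos i)) ≡ j ⊓ m (pos i)
    pointwise i with pos i <? t
    ... | yes lt = sym (m≤n⇒m⊓n≡m (m-below t j i tr hi lt))
    ... | no ¬lt = sym (m≥n⇒m⊓n≡n (m-above t j i lo (≮⇒≥ ¬lt) 1t))

  v≡Vℓ : ∀ t j → 1 ≤ t → t ≤ r → m t ≤ j → j < m (t ∸ 1) → v t j ≡ Vℓ j
  v≡Vℓ t j 1t tr lo hi = tabulate-cong pointwise
    where
    pointwise : ∀ i → (if ⌊ pos i <? t ⌋ then j else 1) ≡ (if ⌊ j <? m (pos i) ⌋ then j else 1)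
    pointwise i with pos i <? t
    ... | yes lt = sym (if-true (j <? m (pos i)) (<-≤-trans hi (m-below t (m (t ∸ 1)) i tr ≤-refl lt)))
    ... | no ¬lt = sym (if-false (j <? m (pos i)) (≤⇒≯ (m-above t j i lo (≮⇒≥ ¬lt) 1t)))

  top≡Uℓ : top ≡ Uℓ (m 1)
  top≡Uℓ = tabulate-cong (λ i → sym (m≥n⇒m⊓n≡n (m-pos≤m1 i)))

  Level : ℕ → Set
  Level j = ∃ λ t → 2 ≤ t × t ≤ r × m t ≤ j × j < m (t ∸ 1)

  level-search : ∀ j → m r ≤ j → ∀ k t → k + t ≡ r → 1 ≤ t → j < m t → Level j
  level-search j mrj zero t refl 1t lt = ⊥-elim (≤⇒≯ mrj lt)
  level-search j mrj (suc k) t eq 1t lt with j <? m (suc t)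
  ... | yes lt' = level-search j mrj k (suc t) (trans (+-suc k t) eq) (s≤s z≤n) lt'
  ... | no ¬lt = suc t , s≤s 1t , subst (suc t ≤_) eq (s≤s (m≤n+m t k)) , ≮⇒≥ ¬lt , lt

  level : ∀ j → m r ≤ j → j < m 1 → Level j
  level j mrj lt = level-search j mrj (suc r') 1 (+-comm (suc r') 1) (s≤s z≤n) lt

  data Kind : V → Set where
    kU : ∀ j → m r ≤ j → j ≤ m 1 → Kind (Uℓ j)
    kV : ∀ j → m r ≤ j → j < m 1 → Kind (Vℓ j)
    kO : Kind ones
    kD : ∀ a → 2 ≤ a → a < m r → Kind (diag a)

  kindOf-diag : ∀ {x} → x ∈ map diag (range 1 (m r)) → Kind x
  kindOf-diag q with ∈-map⁻ diag q
  ... | a , a∈ , refl = diag-kind a (∈-range⁻ a∈)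
    where
    diag-kind : ∀ a → 1 ≤ a × a < m r → Kind (diag a)
    diag-kind (suc zero) _ = kO
    diag-kind (suc (suc a')) (_ , a<) = kD (suc (suc a')) (s≤s (s≤s z≤n)) a<

  kindOf-uv : ∀ {x} t j → 2 ≤ t → t ≤ r → m t ≤ j → j < m (t ∸ 1) → x ∈ (u t j ∷ v t j ∷ []) → Kind x
  kindOf-uv t j 2t tr lo hi (here refl) =
    subst Kind (sym (u≡Uℓ t j (2≤⇒1≤ 2t) tr lo (<⇒≤ hi)))
      (kU j (level-lower 2t tr lo) (<⇒≤ (level-upper 2t tr hi)))
  kindOf-uv t j 2t tr lo hi (there (here refl)) =
    subst Kind (sym (v≡Vℓ t j (2≤⇒1≤ 2t) tr lo hi))
      (kV j (level-lower 2t tr lo) (level-upper 2t tr hi))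

  kindOf : ∀ {x} → x ∈ XT → Kind x
  kindOf (here refl) = subst Kind (sym top≡Uℓ) (kU (m 1) (<⇒≤ mr<m1) ≤-refl)
  kindOf {x} (there p) with ∈-++⁻ (map diag (range 1 (m r))) p
  ... | inj₁ q = kindOf-diag q
  ... | inj₂ q with find (∈-concatMap⁻ _ q)
  ...   | t , t∈ , q' with ∈-range⁻ t∈ | find (∈-concatMap⁻ _ q')
  ...     | (2t , tr') | (j , j∈ , q'') with ∈-range⁻ j∈
  ...       | lo , hi = kindOf-uv t j 2t (≤-pred tr') lo hi q''

  uv∈X : ∀ {y} t j → 2 ≤ t → t ≤ r → m t ≤ j → j < m (t ∸ 1) → y ∈ (u t j ∷ v t j ∷ []) → y ∈ XT
  uv∈X {y} t j 2t tr lo hi p = there (∈-++⁺ʳ (map diag (range 1 (m r)))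
    (∈-concatMap⁺ level-block (lose {P = λ t' → y ∈ level-block t'} (∈-range⁺ 2t (s≤s tr))
       (∈-concatMap⁺ (uv-pair t) (lose {P = λ j' → y ∈ uv-pair t j'} (∈-range⁺ lo hi) p)))))
    where
    uv-pair : ℕ → ℕ → List V
    uv-pair t j = u t j ∷ v t j ∷ []
    level-block : ℕ → List V
    level-block t = concatMap (uv-pair t) (range (m t) (m (t ∸ 1)))

  Uℓ∈X : ∀ j → m r ≤ j → j ≤ m 1 → Uℓ j ∈ XT
  Uℓ∈X j lo hi with j ≟ m 1
  ... | yes refl = subst (_∈ XT) top≡Uℓ (here refl)
  ... | no ne with level j lo (≤∧≢⇒< hi ne)
  ...   | t , 2t , tr , lo' , hi' = uv∈X t j 2t tr lo' hi'
            (here (sym (u≡Uℓ t j (2≤⇒1≤ 2t) tr lo' (<⇒≤ hi'))))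

  Vℓ∈X : ∀ j → m r ≤ j → j < m 1 → Vℓ j ∈ XT
  Vℓ∈X j lo hi with level j lo hi
  ... | t , 2t , tr , lo' , hi' = uv∈X t j 2t tr lo' hi'
            (there (here (sym (v≡Vℓ t j (2≤⇒1≤ 2t) tr lo' hi'))))

  diag∈X : ∀ a → 1 ≤ a → a < m r → diag a ∈ XT
  diag∈X a 1a ar = there (∈-++⁺ˡ (∈-map⁺ diag (∈-range⁺ 1a ar)))

  ones∈X : ones ∈ XT
  ones∈X = diag∈X 1 (s≤s z≤n) 2≤mr

  kind⇒∈X : ∀ {x} → Kind x → x ∈ XT
  kind⇒∈X (kU j lo hi) = Uℓ∈X j lo hi
  kind⇒∈X (kV j lo hi) = Vℓ∈X j lo hi
  kind⇒∈X kO = ones∈X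
  kind⇒∈X (kD a 2a ar) = diag∈X a (≤-trans (s≤s z≤n) 2a) ar

  Disagree : V → V → Set
  Disagree x y = ∀ i → lookup x i ≢ lookup y i

  ≢-via : ∀ {p q a b : ℕ} → p ≡ a → q ≡ b → a ≢ b → p ≢ q
  ≢-via refl refl ne = ne

  Disagree-sym : ∀ {x y : V} → Disagree x y → Disagree y x
  Disagree-sym d i e = d i (sym e)

  lookup-≢⇒≢ : ∀ {x y : V} (i : Fin r) → lookup x i ≢ lookup y i → x ≢ y
  lookup-≢⇒≢ i ne refl = ne refl

  2≤⊓ : ∀ j i → m r ≤ j → 2 ≤ j ⊓ m (pos i)
  2≤⊓ j i lo = ⊓-glb (≤-trans 2≤mr lo) (2≤m-pos i)

  mr≤⊓ : ∀ j i → m r ≤ j → m r ≤ j ⊓ m (pos i)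
  mr≤⊓ j i lo = ⊓-glb lo (mr≤m-pos i)

  Disagree-Uℓ-Vℓ : ∀ j j' → j ≢ j' → m r ≤ j → m r ≤ j' → Disagree (Uℓ j) (Vℓ j')
  Disagree-Uℓ-Vℓ j j' ne lo lo' i with j' <? m (pos i)
  ... | no ¬lt = ≢-via (lookup-Uℓ j i) (lookup-Vℓ-≥ j' i (≮⇒≥ ¬lt)) (>⇒≢ (2≤⊓ j i lo))
  ... | yes lt with j ≤? m (pos i)
  ...   | yes le = ≢-via (trans (lookup-Uℓ j i) (m≤n⇒m⊓n≡m le)) (lookup-Vℓ-< j' i lt) ne
  ...   | no ¬le = ≢-via (trans (lookup-Uℓ j i) (m≥n⇒m⊓n≡n (<⇒≤ (≰⇒> ¬le)))) (lookup-Vℓ-< j' i lt)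
                           (>⇒≢ lt)

  Disagree-Uℓ-ones : ∀ j → m r ≤ j → Disagree (Uℓ j) ones
  Disagree-Uℓ-ones j lo i = ≢-via (lookup-Uℓ j i) (lookup-ones i) (>⇒≢ (2≤⊓ j i lo))

  Disagree-Uℓ-diag : ∀ j a → m r ≤ j → a < m r → Disagree (Uℓ j) (diag a)
  Disagree-Uℓ-diag j a lo ar i = ≢-via (lookup-Uℓ j i) (lookup-diag a i) (>⇒≢ (<-≤-trans ar (mr≤⊓ j i lo)))

  Disagree-Vℓ-diag : ∀ j a → m r ≤ j → 2 ≤ a → a < m r → Disagree (Vℓ j) (diag a)
  Disagree-Vℓ-diag j a lo 2a ar i with j <? m (pos i)
  ... | yes lt = ≢-via (lookup-Vℓ-< j i lt) (lookup-diag a i) (>⇒≢ (<-≤-trans ar lo))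
  ... | no ¬lt = ≢-via (lookup-Vℓ-≥ j i (≮⇒≥ ¬lt)) (lookup-diag a i) (<⇒≢ 2a)

  Disagree-ones-diag : ∀ a → 2 ≤ a → Disagree ones (diag a)
  Disagree-ones-diag a 2a i = ≢-via (lookup-ones i) (lookup-diag a i) (<⇒≢ 2a)

  Disagree-diag-diag : ∀ a a' → a ≢ a' → Disagree (diag a) (diag a')
  Disagree-diag-diag a a' ne i = ≢-via (lookup-diag a i) (lookup-diag a' i) ne

  first : Fin r
  first = F.zero

  last : Fin r
  last = F.fromℕ (suc r')

  penult : Fin r
  penult = F.inject₁ (F.fromℕ r')

  pos-last : pos last ≡ r
  pos-last = cong suc (FP.toℕ-fromℕ (suc r'))

  pos-penult : pos penult ≡ suc r'
  pos-penult = cong suc (trans (FP.toℕ-inject₁ (F.fromℕ r')) (FP.toℕ-fromℕ r'))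

  ones≢Vℓ : ∀ j → m r ≤ j → j < m 1 → ones ≢ Vℓ j
  ones≢Vℓ j lo hi =
    lookup-≢⇒≢ first (≢-via (lookup-ones first) (lookup-Vℓ-< j first hi) (<⇒≢ (≤-trans 2≤mr lo)))

  ones≢Uℓ : ∀ j → m r ≤ j → ones ≢ Uℓ j
  ones≢Uℓ j lo = lookup-≢⇒≢ {ones} {Uℓ j} first (Disagree-sym {Uℓ j} {ones} (Disagree-Uℓ-ones j lo) first)

  t∸1<t : ∀ t → 2 ≤ t → t ∸ 1 < t
  t∸1<t (suc t) _ = ≤-refl

  m-t<m-t∸1 : ∀ t → 2 ≤ t → t ≤ r → m t < m (t ∸ 1)
  m-t<m-t∸1 t 2t tr = decreasing-< t (1≤t∸1 t 2t) (t∸1<t t 2t) tr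

  v-r≡Vℓ : v r (m r) ≡ Vℓ (m r)
  v-r≡Vℓ = v≡Vℓ r (m r) (s≤s z≤n) ≤-refl ≤-refl (<-trans (n<1+n _) mr+1<m[r-1])

  ≉e₂-via-ones : ∀ {a b d a' b' d'} → a ≡ a' → b ≡ b' → d ≡ d' →
           ones ≢ a' → ones ≢ b' → ones ≢ d' → ¬ SameSet (a ∷ b ∷ d ∷ []) e₂
  ≉e₂-via-ones refl refl refl na nb nd ss with Equivalence.from (ss ones) (there (there (here refl)))
  ... | here e = na e
  ... | there (here e) = nb e
  ... | there (there (here e)) = nd e

  ≉e₂-via-Vmr : ∀ {a b d a' b' d'} → a ≡ a' → b ≡ b' → d ≡ d' →
           Vℓ (m r) ≢ a' → Vℓ (m r) ≢ b' → Vℓ (m r) ≢ d' → ¬ SameSet (a ∷ b ∷ d ∷ []) e₂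
  ≉e₂-via-Vmr refl refl refl na nb nd ss with Equivalence.from (ss (v r (m r))) (here refl)
  ... | here e = na (trans (sym v-r≡Vℓ) e)
  ... | there (here e) = nb (trans (sym v-r≡Vℓ) e)
  ... | there (there (here e)) = nd (trans (sym v-r≡Vℓ) e)

  module ProperFacts {k : ℕ} (c : V → Fin k) (pc : Proper HStar1 c) where

    disagree⇒colour≢ : ∀ {x y} → x ∈ XT → y ∈ XT → Disagree x y → c x ≢ c y
    disagree⇒colour≢ {x} {y} xm ym d eq with proj₂ pc (x ∷ y ∷ []) (x , y , xm , ym , refl , d)
    ... | a , b , a∈ , b∈ , ne = ne (same-colour a∈ b∈)
      where
      same-colour : ∀ {a b} → a ∈ x ∷ y ∷ [] → b ∈ x ∷ y ∷ [] → c a ≡ c b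
      same-colour (here refl) (here refl) = refl
      same-colour (here refl) (there (here refl)) = eq
      same-colour (there (here refl)) (here refl) = sym eq
      same-colour (there (here refl)) (there (here refl)) = refl

    cEdge-merges : ∀ {a b d} → CStar (a ∷ b ∷ d ∷ []) → ¬ SameSet (a ∷ b ∷ d ∷ []) e₂ →
                   c a ≡ c b ⊎ c a ≡ c d ⊎ c b ≡ c d
    cEdge-merges {a} {b} {d} cs ns with proj₁ pc _ (cs , ns)
    ... | x , y , x∈ , y∈ , x≢y , eq = pair-merges x∈ y∈ x≢y eq
      where
      pair-merges : ∀ {x y} → x ∈ a ∷ b ∷ d ∷ [] → y ∈ a ∷ b ∷ d ∷ [] → x ≢ y → c x ≡ c y →
          c a ≡ c b ⊎ c a ≡ c d ⊎ c b ≡ c d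
      pair-merges (here refl) (here refl) ne _ = ⊥-elim (ne refl)
      pair-merges (here refl) (there (here refl)) _ e = inj₁ e
      pair-merges (here refl) (there (there (here refl))) _ e = inj₂ (inj₁ e)
      pair-merges (there (here refl)) (here refl) _ e = inj₁ (sym e)
      pair-merges (there (here refl)) (there (here refl)) ne _ = ⊥-elim (ne refl)
      pair-merges (there (here refl)) (there (there (here refl))) _ e = inj₂ (inj₂ e)
      pair-merges (there (there (here refl))) (here refl) _ e = inj₂ (inj₁ (sym e))
      pair-merges (there (there (here refl))) (there (here refl)) _ e = inj₂ (inj₂ (sym e))
      pair-merges (there (there (here refl))) (there (there (here refl))) ne _ = ⊥-elim (ne refl)

    cEdge-merges-via : ∀ {a b d a' b' d'} → CStar (a ∷ b ∷ d ∷ []) → ¬ SameSet (a ∷ b ∷ d ∷ []) e₂ →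
            a ≡ a' → b ≡ b' → d ≡ d' → c a' ≡ c b' ⊎ c a' ≡ c d' ⊎ c b' ≡ c d'
    cEdge-merges-via cs ns refl refl refl = cEdge-merges cs ns

    Merged : ℕ → Set
    Merged j = c (Uℓ j) ≡ c (Vℓ j)

    colour-Uℓ≢Vℓ : ∀ {j j'} → j ≢ j' → m r ≤ j → j ≤ m 1 → m r ≤ j' → j' < m 1 →
                   c (Uℓ j) ≢ c (Vℓ j')
    colour-Uℓ≢Vℓ ne lo hi lo' hi' =
      disagree⇒colour≢ (Uℓ∈X _ lo hi) (Vℓ∈X _ lo' hi') (Disagree-Uℓ-Vℓ _ _ ne lo lo')

    colour-Uℓ≢ones : ∀ {j} → m r ≤ j → j ≤ m 1 → c (Uℓ j) ≢ c ones
    colour-Uℓ≢ones lo hi = disagree⇒colour≢ (Uℓ∈X _ lo hi) ones∈X (Disagree-Uℓ-ones _ lo)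

    merged-or-U-step : ∀ j → m r ≤ j → j < m 1 → c (Vℓ j) ≡ c (Uℓ j) ⊎ c (Uℓ j) ≡ c (Uℓ (suc j))
    merged-or-U-step j lo hi with level j lo hi
    ... | t , 2t , tr , lo' , hi' =
      drop-middle (λ e → colour-Uℓ≢Vℓ (>⇒≢ (n<1+n j)) lo1 hi lo hi (sym e))
        (cEdge-merges-via (c₂ t j 2t tr lo' (<⇒≤pred hi'))
          (≉e₂-via-ones eV eU eU' (ones≢Vℓ j lo hi) (ones≢Uℓ j lo) (ones≢Uℓ (suc j) lo1)) eV eU eU')
      where
      lo1 = m≤n⇒m≤1+n lo
      eV = v≡Vℓ t j (2≤⇒1≤ 2t) tr lo' hi'
      eU = u≡Uℓ t j (2≤⇒1≤ 2t) tr lo' (<⇒≤ hi')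
      eU' = trans (u≡Uℓ t (j + 1) (2≤⇒1≤ 2t) tr (≤-trans lo' (m≤m+n j 1))
                        (subst (_≤ m (t ∸ 1)) (sym (+-comm j 1)) hi'))
                  (cong Uℓ (+-comm j 1))

    merged-or-V-step : ∀ t j → 2 ≤ t → t ≤ r → m t ≤ j → suc j < m (t ∸ 1) →
                       c (Uℓ (suc j)) ≡ c (Vℓ (suc j)) ⊎ c (Vℓ (suc j)) ≡ c (Vℓ j)
    merged-or-V-step t j 2t tr lo hi =
      drop-middle (colour-Uℓ≢Vℓ (>⇒≢ (n<1+n j)) lo1 (<⇒≤ hi1) lo0 hi0)
        (cEdge-merges-via (c₁ t (suc j) 2t tr (subst (_≤ suc j) (sym (+-comm (m t) 1)) (s≤s lo)) (<⇒≤pred hi))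
          (≉e₂-via-ones eU eV eV' (ones≢Uℓ (suc j) lo1) (ones≢Vℓ (suc j) lo1 hi1) (ones≢Vℓ j lo0 hi0)) eU eV eV')
      where
      lo0 = level-lower 2t tr lo
      lo1 = m≤n⇒m≤1+n lo0
      hi1 = level-upper 2t tr hi
      hi0 = <-trans (n<1+n j) hi1
      eU = u≡Uℓ t (suc j) (2≤⇒1≤ 2t) tr (m≤n⇒m≤1+n lo) (<⇒≤ hi)
      eV = v≡Vℓ t (suc j) (2≤⇒1≤ 2t) tr (m≤n⇒m≤1+n lo) hi
      eV' = v≡Vℓ t j (2≤⇒1≤ 2t) tr lo (<-trans (n<1+n j) hi)

    merged-or-V≡ones : ∀ t → 2 ≤ t → t < r → c (Uℓ (m t)) ≡ c (Vℓ (m t)) ⊎ c (Vℓ (m t)) ≡ c ones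
    merged-or-V≡ones t 2t t<r =
      drop-middle (colour-Uℓ≢ones mr≤mt (m≤m1 t (2≤⇒1≤ 2t) tr))
        (cEdge-merges-via (c₃ t 2t tr) (≉e₂-via-Vmr eU eV refl Vmr≢U Vmr≢V Vmr≢ones) eU eV refl)
      where
      tr = <⇒≤ t<r
      mr≤mt = mr≤m t (2≤⇒1≤ 2t) tr
      mt<m[t-1] = m-t<m-t∸1 t 2t tr
      eU = u≡Uℓ t (m t) (2≤⇒1≤ 2t) tr ≤-refl (<⇒≤ mt<m[t-1])
      eV = v≡Vℓ t (m t) (2≤⇒1≤ 2t) tr ≤-refl mt<m[t-1]
      mr≢mt : m r ≢ m t
      mr≢mt = <⇒≢ (decreasing-< r (2≤⇒1≤ 2t) t<r ≤-refl)
      Vmr≢U : Vℓ (m r) ≢ Uℓ (m t)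
      Vmr≢U = lookup-≢⇒≢ first
        (Disagree-sym {Uℓ (m t)} {Vℓ (m r)} (Disagree-Uℓ-Vℓ (m t) (m r) (≢-sym mr≢mt) mr≤mt ≤-refl) first)
      Vmr≢V : Vℓ (m r) ≢ Vℓ (m t)
      Vmr≢V = lookup-≢⇒≢ first (≢-via (lookup-Vℓ-< (m r) first mr<m1)
                                       (lookup-Vℓ-< (m t) first (level-upper 2t tr mt<m[t-1])) mr≢mt)
      Vmr≢ones : Vℓ (m r) ≢ ones
      Vmr≢ones e = ones≢Vℓ (m r) ≤-refl mr<m1 (sym e)

    merged-pred : ∀ j → m r ≤ j → suc j < m 1 → Merged (suc j) → Merged j
    merged-pred j lo hi mt with merged-or-U-step j lo (<-trans (n<1+n j) hi)
    ... | inj₁ e = sym e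
    ... | inj₂ e =
      ⊥-elim (colour-Uℓ≢Vℓ (<⇒≢ (n<1+n j)) lo (<⇒≤ (<-trans (n<1+n j) hi)) (m≤n⇒m≤1+n lo) hi (trans e mt))

    unmerged-upward : ∀ j j' → m r ≤ j → j ≤ j' → j' < m 1 → ¬ Merged j → ¬ Merged j'
    unmerged-upward j zero lo le hi nm = ⊥-elim (n≮0 (≤-trans 2≤mr (≤-trans lo le)))
    unmerged-upward j (suc j') lo le hi nm with m≤n⇒m<n∨m≡n le
    ... | inj₂ refl = nm
    ... | inj₁ lt = λ mt → unmerged-upward j j' lo (≤-pred lt) (<-trans (n<1+n j') hi) nm
                             (merged-pred j' (≤-trans lo (≤-pred lt)) hi mt)

    V-step-unmerged : ∀ t j → 2 ≤ t → t ≤ r → m t ≤ j → suc j < m (t ∸ 1) → ¬ Merged (suc j) →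
         c (Vℓ (suc j)) ≡ c (Vℓ j) × ¬ Merged j
    V-step-unmerged t j 2t tr lo hi nm with merged-or-V-step t j 2t tr lo hi
    ... | inj₁ e = ⊥-elim (nm e)
    ... | inj₂ e = e , λ mt → colour-Uℓ≢Vℓ (<⇒≢ (n<1+n j)) lo0 (<⇒≤ hi0) lo1 hi1 (trans mt (sym e))
      where
      lo0 = level-lower 2t tr lo
      lo1 = m≤n⇒m≤1+n lo0
      hi1 = level-upper 2t tr hi
      hi0 = <-trans (n<1+n j) hi1

    Uℓ-colour-constant : ∀ j j' → m r ≤ j → j ≤ j' → j' ≤ m 1 → (j < m 1 → ¬ Merged j) →
                         c (Uℓ j) ≡ c (Uℓ j')
    Uℓ-colour-constant j zero lo le hi nm = ⊥-elim (n≮0 (≤-trans 2≤mr (≤-trans lo le)))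
    Uℓ-colour-constant j (suc j') lo le hi nm with m≤n⇒m<n∨m≡n le
    ... | inj₂ refl = refl
    ... | inj₁ lt with merged-or-U-step j' (≤-trans lo (≤-pred lt)) hi
    ...   | inj₁ e = ⊥-elim (unmerged-upward j j' lo (≤-pred lt) hi (nm (≤-<-trans (≤-pred lt) hi)) (sym e))
    ...   | inj₂ e = trans (Uℓ-colour-constant j j' lo (≤-pred lt) (<⇒≤ hi) nm) e

    -- Going down from an unmerged j, c₁-edges chain Vℓ j to Vℓ m_t at the bottom of its level
    -- and a c₃-edge joins that to (1,…,1); in level r that c₃-edge is e₂, so the chain stops at Vℓ m_r.
    Vℓ≡ones-above : ∀ j → m (suc r') ≤ j → j < m 1 → ¬ Merged j → c (Vℓ j) ≡ c ones
    Vℓ≡ones-above zero lo hi nm = ⊥-elim (n≮0 (<-≤-trans mr+1<m[r-1] lo))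
    Vℓ≡ones-above (suc j) lo hi nm with level (suc j) (≤-trans (<⇒≤ (<-trans (n<1+n _) mr+1<m[r-1])) lo) hi
    ... | t , 2t , tr , lo' , hi' with m≤n⇒m<n∨m≡n tr | m t ≟ suc j
    ...   | inj₂ refl | _ = ⊥-elim (≤⇒≯ lo hi')
    ...   | inj₁ t<r | yes mt≡1+j =
      subst (λ z → c (Vℓ z) ≡ c ones) mt≡1+j
        (fromInj₂ (λ e → ⊥-elim (nm (subst Merged mt≡1+j e))) (merged-or-V≡ones t 2t t<r))
    ...   | inj₁ t<r | no mt≢1+j =
      trans (proj₁ step) (Vℓ≡ones-above j m[r-1]≤j (<-trans (n<1+n j) hi) (proj₂ step))
      where
      mt≤j = ≤-pred (≤∧≢⇒< lo' mt≢1+j)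
      step = V-step-unmerged t j 2t tr mt≤j hi' nm
      m[r-1]≤j = ≤-trans (decreasing-≤ (suc r') (2≤⇒1≤ 2t) (≤-pred t<r) (n≤1+n _)) mt≤j

    Vℓ≡Vmr-below : ∀ j → m r ≤ j → j < m (suc r') → ¬ Merged j → c (Vℓ j) ≡ c (Vℓ (m r))
    Vℓ≡Vmr-below zero lo hi nm = ⊥-elim (n≮0 (≤-trans 2≤mr lo))
    Vℓ≡Vmr-below (suc j) lo hi nm with m r ≟ suc j
    ... | yes mr≡1+j = cong (λ z → c (Vℓ z)) (sym mr≡1+j)
    ... | no mr≢1+j =
      trans (proj₁ step) (Vℓ≡Vmr-below j mr≤j (<-trans (n<1+n j) hi) (proj₂ step))
      where
      mr≤j = ≤-pred (≤∧≢⇒< lo mr≢1+j)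
      step = V-step-unmerged r j (s≤s (s≤s z≤n)) ≤-refl mr≤j hi nm

    Joined : Set
    Joined = c (Vℓ (m r)) ≡ c ones

    Vℓ≡ones : ∀ j → m r ≤ j → j < m 1 → ¬ Merged j → (j < m (suc r') → Joined) → c (Vℓ j) ≡ c ones
    Vℓ≡ones j lo hi nm w with j <? m (suc r')
    ... | yes lt = trans (Vℓ≡Vmr-below j lo lt nm) (w lt)
    ... | no ¬lt = Vℓ≡ones-above j (≮⇒≥ ¬lt) hi nm

  SameSide : ℕ → ℕ → Set
  SameSide j j' = (j < m (suc r') × j' < m (suc r')) ⊎ (m (suc r') ≤ j × m (suc r') ≤ j')

  -- Read P j as "Uℓ j and Vℓ j share a colour" and J as "Vℓ m_r and (1,…,1) share a colour":
  -- then the unmerged Uℓ's form one class, and the unmerged Vℓ's split at m_{r-1} into a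
  -- class containing Vℓ m_r and one containing (1,…,1), which fuse exactly when J holds.
  SameClass : (ℕ → Set) → Set → ∀ {x y} → Kind x → Kind y → Set
  SameClass P J (kU j _ _) (kU j' _ _) = j ≡ j' ⊎ (¬ (j < m 1 × P j) × ¬ (j' < m 1 × P j'))
  SameClass P J (kU j _ _) (kV j' _ _) = j ≡ j' × P j'
  SameClass P J (kV j _ _) (kU j' _ _) = j' ≡ j × P j
  SameClass P J (kV j _ _) (kV j' _ _) = j ≡ j' ⊎ (¬ P j × ¬ P j' × (SameSide j j' ⊎ J))
  SameClass P J (kV j _ _) kO = ¬ P j × (m (suc r') ≤ j ⊎ J)
  SameClass P J kO (kV j _ _) = ¬ P j × (m (suc r') ≤ j ⊎ J)
  SameClass P J kO kO = ⊤
  SameClass P J (kD a _ _) (kD a' _ _) = a ≡ a'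
  SameClass P J _ _ = ⊥

  ≡-sym-⇔ : ∀ {A : Set} {a b : A} → (a ≡ b) ⇔ (b ≡ a)
  ≡-sym-⇔ = mk⇔ sym sym

  module Characterisation {k : ℕ} (c : V → Fin k) (pc : Proper HStar1 c) where
    open ProperFacts c pc

    Class : ∀ {x y} → Kind x → Kind y → Set
    Class = SameClass Merged Joined

    apart : ∀ {x y} → x ∈ XT → y ∈ XT → Disagree x y → (c x ≡ c y) ⇔ ⊥
    apart x∈X y∈X d = mk⇔ (disagree⇒colour≢ x∈X y∈X d) ⊥-elim

    apart-sym : ∀ {x y} → x ∈ XT → y ∈ XT → Disagree y x → (c x ≡ c y) ⇔ ⊥
    apart-sym x∈X y∈X d = mk⇔ (λ e → disagree⇒colour≢ y∈X x∈X d (sym e)) ⊥-elim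

    Uℓ-Uℓ : ∀ j j' (lo : m r ≤ j) (hi : j ≤ m 1) (lo' : m r ≤ j') (hi' : j' ≤ m 1) →
            (c (Uℓ j) ≡ c (Uℓ j')) ⇔ Class (kU j lo hi) (kU j' lo' hi')
    Uℓ-Uℓ j j' lo hi lo' hi' = mk⇔ to from
      where
      unmerged : ∀ {i i'} → m r ≤ i → m r ≤ i' → i' ≤ m 1 → i ≢ i' → c (Uℓ i) ≡ c (Uℓ i') →
                 ¬ (i < m 1 × Merged i)
      unmerged lo lo' hi' i≢i' e (lt , mi) = colour-Uℓ≢Vℓ (≢-sym i≢i') lo' hi' lo lt (trans (sym e) mi)
      to : c (Uℓ j) ≡ c (Uℓ j') → Class (kU j lo hi) (kU j' lo' hi')
      to e with j ≟ j'
      ... | yes j≡j' = inj₁ j≡j'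
      ... | no j≢j' = inj₂ (unmerged lo lo' hi' j≢j' e , unmerged lo' lo hi (≢-sym j≢j') (sym e))
      from : Class (kU j lo hi) (kU j' lo' hi') → c (Uℓ j) ≡ c (Uℓ j')
      from (inj₁ refl) = refl
      from (inj₂ (¬mj , ¬mj')) = trans (Uℓ-colour-constant j (m 1) lo hi ≤-refl (curry ¬mj))
                                       (sym (Uℓ-colour-constant j' (m 1) lo' hi' ≤-refl (curry ¬mj')))

    Uℓ-Vℓ : ∀ j j' (lo : m r ≤ j) (hi : j ≤ m 1) (lo' : m r ≤ j') (hi' : j' < m 1) →
            (c (Uℓ j) ≡ c (Vℓ j')) ⇔ Class (kU j lo hi) (kV j' lo' hi')
    Uℓ-Vℓ j j' lo hi lo' hi' = mk⇔ to from
      where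
      to : c (Uℓ j) ≡ c (Vℓ j') → j ≡ j' × Merged j'
      to e with j ≟ j'
      ... | yes refl = refl , e
      ... | no j≢j' = ⊥-elim (colour-Uℓ≢Vℓ j≢j' lo hi lo' hi' e)
      from : j ≡ j' × Merged j' → c (Uℓ j) ≡ c (Vℓ j')
      from (refl , mj) = mj

    Vℓ-Vℓ : ∀ j j' (lo : m r ≤ j) (hi : j < m 1) (lo' : m r ≤ j') (hi' : j' < m 1) →
            (c (Vℓ j) ≡ c (Vℓ j')) ⇔ Class (kV j lo hi) (kV j' lo' hi')
    Vℓ-Vℓ j j' lo hi lo' hi' = mk⇔ to from
      where
      to : c (Vℓ j) ≡ c (Vℓ j') → Class (kV j lo hi) (kV j' lo' hi')
      to e with j ≟ j'
      ... | yes j≡j' = inj₁ j≡j'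
      ... | no j≢j' = inj₂ (¬mj , ¬mj' , side (j <? m (suc r')) (j' <? m (suc r')))
        where
        ¬mj = λ mj → colour-Uℓ≢Vℓ j≢j' lo (<⇒≤ hi) lo' hi' (trans mj e)
        ¬mj' = λ mj' → colour-Uℓ≢Vℓ (≢-sym j≢j') lo' (<⇒≤ hi') lo hi (trans mj' (sym e))
        side : Dec (j < m (suc r')) → Dec (j' < m (suc r')) → SameSide j j' ⊎ Joined
        side (yes l) (yes l') = inj₁ (inj₁ (l , l'))
        side (no l) (no l') = inj₁ (inj₂ (≮⇒≥ l , ≮⇒≥ l'))
        side (yes l) (no l') =
          inj₂ (trans (sym (Vℓ≡Vmr-below j lo l ¬mj)) (trans e (Vℓ≡ones-above j' (≮⇒≥ l') hi' ¬mj')))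
        side (no l) (yes l') =
          inj₂ (trans (sym (Vℓ≡Vmr-below j' lo' l' ¬mj')) (trans (sym e) (Vℓ≡ones-above j (≮⇒≥ l) hi ¬mj)))
      from : Class (kV j lo hi) (kV j' lo' hi') → c (Vℓ j) ≡ c (Vℓ j')
      from (inj₁ refl) = refl
      from (inj₂ (¬mj , ¬mj' , inj₁ (inj₁ (l , l')))) =
        trans (Vℓ≡Vmr-below j lo l ¬mj) (sym (Vℓ≡Vmr-below j' lo' l' ¬mj'))
      from (inj₂ (¬mj , ¬mj' , inj₁ (inj₂ (h , h')))) =
        trans (Vℓ≡ones-above j h hi ¬mj) (sym (Vℓ≡ones-above j' h' hi' ¬mj'))
      from (inj₂ (¬mj , ¬mj' , inj₂ J)) =
        trans (Vℓ≡ones j lo hi ¬mj (λ _ → J)) (sym (Vℓ≡ones j' lo' hi' ¬mj' (λ _ → J)))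

    Vℓ-ones : ∀ j (lo : m r ≤ j) (hi : j < m 1) → (c (Vℓ j) ≡ c ones) ⇔ Class (kV j lo hi) kO
    Vℓ-ones j lo hi = mk⇔ to from
      where
      to : c (Vℓ j) ≡ c ones → ¬ Merged j × (m (suc r') ≤ j ⊎ Joined)
      to e with j <? m (suc r')
      ... | yes l = ¬mj , inj₂ (trans (sym (Vℓ≡Vmr-below j lo l ¬mj)) e)
        where ¬mj = λ mj → colour-Uℓ≢ones lo (<⇒≤ hi) (trans mj e)
      ... | no l = (λ mj → colour-Uℓ≢ones lo (<⇒≤ hi) (trans mj e)) , inj₁ (≮⇒≥ l)
      from : ¬ Merged j × (m (suc r') ≤ j ⊎ Joined) → c (Vℓ j) ≡ c ones
      from (¬mj , inj₁ h) = Vℓ≡ones-above j h hi ¬mj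
      from (¬mj , inj₂ J) = Vℓ≡ones j lo hi ¬mj (λ _ → J)

    diag-diag : ∀ a a' (2a : 2 ≤ a) (ar : a < m r) (2a' : 2 ≤ a') (ar' : a' < m r) →
                (c (diag a) ≡ c (diag a')) ⇔ Class (kD a 2a ar) (kD a' 2a' ar')
    diag-diag a a' 2a ar 2a' ar' = mk⇔ to λ { refl → refl }
      where
      to : c (diag a) ≡ c (diag a') → a ≡ a'
      to e with a ≟ a'
      ... | yes a≡a' = a≡a'
      ... | no a≢a' = ⊥-elim (disagree⇒colour≢ (kind⇒∈X (kD a 2a ar)) (kind⇒∈X (kD a' 2a' ar'))
                                                (Disagree-diag-diag a a' a≢a') e)

    colour≡⇔SameClass : ∀ {x y} (kx : Kind x) (ky : Kind y) → (c x ≡ c y) ⇔ Class kx ky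
    colour≡⇔SameClass (kU j lo hi) (kU j' lo' hi') = Uℓ-Uℓ j j' lo hi lo' hi'
    colour≡⇔SameClass (kU j lo hi) (kV j' lo' hi') = Uℓ-Vℓ j j' lo hi lo' hi'
    colour≡⇔SameClass (kV j lo hi) (kU j' lo' hi') = ⇔.trans ≡-sym-⇔ (Uℓ-Vℓ j' j lo' hi' lo hi)
    colour≡⇔SameClass (kV j lo hi) (kV j' lo' hi') = Vℓ-Vℓ j j' lo hi lo' hi'
    colour≡⇔SameClass (kV j lo hi) kO = Vℓ-ones j lo hi
    colour≡⇔SameClass kO (kV j lo hi) = ⇔.trans ≡-sym-⇔ (Vℓ-ones j lo hi)
    colour≡⇔SameClass kO kO = mk⇔ (λ _ → tt) (λ _ → refl)
    colour≡⇔SameClass (kD a 2a ar) (kD a' 2a' ar') = diag-diag a a' 2a ar 2a' ar'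
    colour≡⇔SameClass kx@(kU j lo hi) ky@kO = apart (kind⇒∈X kx) (kind⇒∈X ky) (Disagree-Uℓ-ones j lo)
    colour≡⇔SameClass kx@kO ky@(kU j lo hi) = apart-sym (kind⇒∈X kx) (kind⇒∈X ky) (Disagree-Uℓ-ones j lo)
    colour≡⇔SameClass kx@(kU j lo hi) ky@(kD a _ ar) = apart (kind⇒∈X kx) (kind⇒∈X ky) (Disagree-Uℓ-diag j a lo ar)
    colour≡⇔SameClass kx@(kD a _ ar) ky@(kU j lo hi) = apart-sym (kind⇒∈X kx) (kind⇒∈X ky) (Disagree-Uℓ-diag j a lo ar)
    colour≡⇔SameClass kx@(kV j lo hi) ky@(kD a 2a ar) = apart (kind⇒∈X kx) (kind⇒∈X ky) (Disagree-Vℓ-diag j a lo 2a ar)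
    colour≡⇔SameClass kx@(kD a 2a ar) ky@(kV j lo hi) = apart-sym (kind⇒∈X kx) (kind⇒∈X ky) (Disagree-Vℓ-diag j a lo 2a ar)
    colour≡⇔SameClass kx@kO ky@(kD a 2a _) = apart (kind⇒∈X kx) (kind⇒∈X ky) (Disagree-ones-diag a 2a)
    colour≡⇔SameClass kx@(kD a 2a _) ky@kO = apart-sym (kind⇒∈X kx) (kind⇒∈X ky) (Disagree-ones-diag a 2a)

  module _ {P P' : ℕ → Set} {J J' : Set} (P⇒P' : ∀ j → m r ≤ j → j < m 1 → P j ⇔ P' j) (J⇒J' : J ⇔ J') where
    private
      ¬P⇒¬P' : ∀ {j} → m r ≤ j → j < m 1 → ¬ P j → ¬ P' j
      ¬P⇒¬P' lo hi ¬p p' = ¬p (Equivalence.from (P⇒P' _ lo hi) p')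
      side-resp : ∀ {A : Set} → A ⊎ J → A ⊎ J'
      side-resp (inj₁ a) = inj₁ a
      side-resp (inj₂ w) = inj₂ (Equivalence.to J⇒J' w)

    SameClass-resp : ∀ {x y} (kx : Kind x) (ky : Kind y) → SameClass P J kx ky → SameClass P' J' kx ky
    SameClass-resp (kU j lo hi) (kU j' lo' hi') (inj₁ e) = inj₁ e
    SameClass-resp (kU j lo hi) (kU j' lo' hi') (inj₂ (¬pj , ¬pj')) =
      inj₂ ((λ { (lt , p') → ¬P⇒¬P' lo lt (curry ¬pj lt) p' }) ,
            (λ { (lt , p') → ¬P⇒¬P' lo' lt (curry ¬pj' lt) p' }))
    SameClass-resp (kU j lo hi) (kV j' lo' hi') (e , p) = e , Equivalence.to (P⇒P' j' lo' hi') p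
    SameClass-resp (kV j lo hi) (kU j' lo' hi') (e , p) = e , Equivalence.to (P⇒P' j lo hi) p
    SameClass-resp (kV j lo hi) (kV j' lo' hi') (inj₁ e) = inj₁ e
    SameClass-resp (kV j lo hi) (kV j' lo' hi') (inj₂ (¬pj , ¬pj' , side)) =
      inj₂ (¬P⇒¬P' lo hi ¬pj , ¬P⇒¬P' lo' hi' ¬pj' , side-resp side)
    SameClass-resp (kV j lo hi) kO (¬pj , side) = ¬P⇒¬P' lo hi ¬pj , side-resp side
    SameClass-resp kO (kV j lo hi) (¬pj , side) = ¬P⇒¬P' lo hi ¬pj , side-resp side
    SameClass-resp kO kO tt = tt
    SameClass-resp (kD _ _ _) (kD _ _ _) e = e
    SameClass-resp (kU _ _ _) kO ()
    SameClass-resp (kU _ _ _) (kD _ _ _) ()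
    SameClass-resp (kV _ _ _) (kD _ _ _) ()
    SameClass-resp kO (kU _ _ _) ()
    SameClass-resp kO (kD _ _ _) ()
    SameClass-resp (kD _ _ _) (kU _ _ _) ()
    SameClass-resp (kD _ _ _) (kV _ _ _) ()
    SameClass-resp (kD _ _ _) kO ()

  data Shape : Set where
    threshold : (q : ℕ) → 1 ≤ q → q ≤ r → Shape
    exceptional : Shape

  ShapeMerged : Shape → ℕ → Set
  ShapeMerged (threshold q _ _) j = j < m q
  ShapeMerged exceptional j = ⊥

  ShapeJoined : Shape → Set
  ShapeJoined (threshold q _ _) = q ≡ r
  ShapeJoined exceptional = ⊥

  colours : Shape → ℕ
  colours (threshold q _ _) = m q
  colours exceptional = suc (m r)

  HasShape : ∀ {k} (c : V → Fin k) → Shape → Set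
  HasShape c τ = (∀ j → m r ≤ j → j < m 1 → (c (Uℓ j) ≡ c (Vℓ j)) ⇔ ShapeMerged τ j) ×
                 ((c (Vℓ (m r)) ≡ c ones) ⇔ ShapeJoined τ)

  same-shape⇒kernel⊆ : ∀ {k k'} (c : V → Fin k) (c' : V → Fin k') {τ : Shape} →
                       Proper HStar1 c → Proper HStar1 c' → HasShape c τ → HasShape c' τ →
                       ∀ x y → x ∈ XT → y ∈ XT → c x ≡ c y → c' x ≡ c' y
  same-shape⇒kernel⊆ c c' pc pc' (merged , joined) (merged' , joined') x y x∈X y∈X e =
    Equivalence.from (Characterisation.colour≡⇔SameClass c' pc' kx ky)
      (SameClass-resp (λ j lo hi → ⇔.sym (merged' j lo hi)) (⇔.sym joined') kx ky
        (SameClass-resp merged joined kx ky (Equivalence.to (Characterisation.colour≡⇔SameClass c pc kx ky) e)))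
    where
    kx = kindOf x∈X
    ky = kindOf y∈X

  module Classify {k : ℕ} (c : V → Fin k) (pc : Proper HStar1 c) where
    open ProperFacts c pc

    first-unmerged-is-threshold : ∀ a → m r ≤ a → a < m 1 → ¬ Merged a →
                                  (∀ j → m r ≤ j → j < a → Merged j) →
                                  ∃ λ t → 2 ≤ t × t ≤ r × m t ≡ a
    first-unmerged-is-threshold a lo hi ¬ma below with level a lo hi
    ... | t , 2t , tr , mt≤a , a<m[t-1] with m t ≟ a
    ...   | yes mt≡a = t , 2t , tr , mt≡a
    ...   | no mt≢a with ≤∧≢⇒< mt≤a mt≢a
    ...     | s≤s {n = a'} mt≤a' = ⊥-elim (proj₂ (V-step-unmerged t a' 2t tr mt≤a' a<m[t-1] ¬ma)
                                             (below a' (level-lower 2t tr mt≤a') (n<1+n a')))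

    merged⇔<first : ∀ a → m r ≤ a → ¬ Merged a → (∀ j → m r ≤ j → j < a → Merged j) →
                    ∀ j → m r ≤ j → j < m 1 → Merged j ⇔ (j < a)
    merged⇔<first a lo ¬ma below j lo' hi = mk⇔ to (below j lo')
      where
      to : Merged j → j < a
      to mj with j <? a
      ... | yes j<a = j<a
      ... | no j≮a = ⊥-elim (unmerged-upward a j lo (≮⇒≥ j≮a) hi ¬ma mj)

    merged⇒¬Joined : Merged (m r) → ¬ Joined
    merged⇒¬Joined mmr J = colour-Uℓ≢ones ≤-refl (<⇒≤ mr<m1) (trans mmr J)

    shapeOf : Σ Shape (HasShape c)
    shapeOf with firstCounterexample Merged (λ j → c (Uℓ j) FP.≟ c (Vℓ j)) (m r) (m 1)
    ... | inj₁ all = threshold 1 ≤-refl (s≤s z≤n) ,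
                     (λ j lo hi → mk⇔ (λ _ → hi) (λ _ → all j lo hi)) ,
                     mk⇔ (λ J → ⊥-elim (merged⇒¬Joined (all (m r) ≤-refl mr<m1) J)) (λ ())
    ... | inj₂ (a , lo , hi , ¬ma , below) with first-unmerged-is-threshold a lo hi ¬ma below
    ...   | t , 2t , tr , refl with m≤n⇒m<n∨m≡n tr | c (Vℓ (m r)) FP.≟ c ones
    ...     | inj₁ t<r | _ = threshold t (2≤⇒1≤ 2t) tr , merged⇔<first (m t) lo ¬ma below ,
                             mk⇔ (λ J → ⊥-elim (¬J J)) (λ t≡r → ⊥-elim (<⇒≢ t<r t≡r))
      where
      ¬J : Joined → ⊥
      ¬J = merged⇒¬Joined (below (m r) ≤-refl (decreasing-< r (2≤⇒1≤ 2t) t<r ≤-refl))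
    ...     | inj₂ t≡r | yes J = threshold t (2≤⇒1≤ 2t) tr , merged⇔<first (m t) lo ¬ma below , mk⇔ (λ _ → t≡r) (λ _ → J)
    ...     | inj₂ refl | no ¬J = exceptional , (λ j lo' hi' → mk⇔ (unmerged j lo' hi') ⊥-elim) , mk⇔ ¬J ⊥-elim
      where
      unmerged : ∀ j → m r ≤ j → j < m 1 → ¬ Merged j
      unmerged j lo' hi' mj = ≤⇒≯ lo' (Equivalence.to (merged⇔<first (m r) lo ¬ma below j lo' hi') mj)

  lookup-bounds : ∀ {x} → Kind x → ∀ i → 1 ≤ lookup x i × lookup x i ≤ m (pos i)
  lookup-bounds (kU j lo hi) i rewrite lookup-Uℓ j i = ≤-trans (s≤s z≤n) (2≤⊓ j i lo) , m⊓n≤n j (m (pos i))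
  lookup-bounds (kV j lo hi) i with j <? m (pos i)
  ... | yes lt rewrite lookup-Vℓ-< j i lt = ≤-trans (s≤s z≤n) (≤-trans 2≤mr lo) , <⇒≤ lt
  ... | no ¬lt rewrite lookup-Vℓ-≥ j i (≮⇒≥ ¬lt) = s≤s z≤n , ≤-trans (s≤s z≤n) (2≤m-pos i)
  lookup-bounds kO i rewrite lookup-ones i = s≤s z≤n , ≤-trans (s≤s z≤n) (2≤m-pos i)
  lookup-bounds (kD a 2a ar) i rewrite lookup-diag a i = ≤-trans (s≤s z≤n) 2a , ≤-trans (<⇒≤ ar) (mr≤m-pos i)

  lookup-bounds-X : ∀ {x} → x ∈ XT → ∀ i → 1 ≤ lookup x i × lookup x i ≤ m (pos i)
  lookup-bounds-X xm = lookup-bounds (kindOf xm)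

  swap-∈ : ∀ {x : V} {a b l} → x ∈ a ∷ b ∷ l → x ∈ b ∷ a ∷ l
  swap-∈ (here e) = there (here e)
  swap-∈ (there (here e)) = here e
  swap-∈ (there (there p)) = there (there p)

  last-c₃≈e₂ : SameSet (u r (m r) ∷ v r (m r) ∷ ones ∷ []) e₂
  last-c₃≈e₂ x = mk⇔ swap-∈ swap-∈

  u≢v : ∀ t j → t ≤ r → u t j ≢ v t j
  u≢v t j tr = lookup-≢⇒≢ {u t j} {v t j} last
    (≢-via (lookup-u-≥ t j last (subst (t ≤_) (sym pos-last) tr)) (lookup-v-≥ t j last (subst (t ≤_) (sym pos-last) tr))
            (>⇒≢ (2≤m-pos last)))

  cEdges-hit : ∀ {k} (ψ : V → Fin k) →
    (∀ t j → 2 ≤ t → t ≤ r → m t + 1 ≤ j → ψ (u t j) ≡ ψ (v t j) ⊎ ψ (v t j) ≡ ψ (v t (j ∸ 1))) →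
    (∀ t j → 2 ≤ t → t ≤ r → m t ≤ j → ψ (v t j) ≡ ψ (u t j) ⊎ ψ (u t j) ≡ ψ (u t (j + 1))) →
    (∀ t → 2 ≤ t → t < r → ψ (u t (m t)) ≡ ψ (v t (m t)) ⊎ ψ (v t (m t)) ≡ ψ ones) →
    ∀ e → CStar e × ¬ SameSet e e₂ → ∃[ x ] ∃[ y ] (x ∈ e × y ∈ e × ¬ (x ≡ y) × ψ x ≡ ψ y)
  cEdges-hit ψ on-c₁ on-c₂ on-c₃ _ (c₁ t j 2t tr lo hi , _) with on-c₁ t j 2t tr lo
  ... | inj₁ e = u t j , v t j , here refl , there (here refl) , u≢v t j tr , e
  ... | inj₂ e = v t j , v t (j ∸ 1) , there (here refl) , there (there (here refl)) , v≢v , e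
    where
    v≢v : v t j ≢ v t (j ∸ 1)
    v≢v = lookup-≢⇒≢ first (≢-via (lookup-v-< t j first 2t) (lookup-v-< t (j ∸ 1) first 2t) (j≢j∸1 j (≤-trans (m≤n+m 1 (m t)) lo)))
      where
      j≢j∸1 : ∀ j → 1 ≤ j → j ≢ j ∸ 1
      j≢j∸1 (suc j) _ = >⇒≢ (n<1+n j)
  cEdges-hit ψ on-c₁ on-c₂ on-c₃ _ (c₂ t j 2t tr lo hi , _) with on-c₂ t j 2t tr lo
  ... | inj₁ e = v t j , u t j , here refl , there (here refl) , ≢-sym (u≢v t j tr) , e
  ... | inj₂ e = u t j , u t (j + 1) , there (here refl) , there (there (here refl)) , u≢u , e
    where
    u≢u : u t j ≢ u t (j + 1)
    u≢u = lookup-≢⇒≢ first (≢-via (lookup-u-< t j first 2t) (lookup-u-< t (j + 1) first 2t) (<⇒≢ (m<m+n j (s≤s z≤n))))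
  cEdges-hit ψ on-c₁ on-c₂ on-c₃ _ (c₃ t 2t tr , ≉e₂) with m≤n⇒m<n∨m≡n tr
  ... | inj₂ refl = ⊥-elim (≉e₂ last-c₃≈e₂)
  ... | inj₁ t<r with on-c₃ t 2t t<r
  ...   | inj₁ e = u t (m t) , v t (m t) , here refl , there (here refl) , u≢v t (m t) tr , e
  ...   | inj₂ e = v t (m t) , ones , there (here refl) , there (there (here refl)) , v≢ones , e
    where
    v≢ones : v t (m t) ≢ ones
    v≢ones = lookup-≢⇒≢ first (≢-via (lookup-v-< t (m t) first 2t) (lookup-ones first) (>⇒≢ (≤-trans 2≤mr (mr≤m t (2≤⇒1≤ 2t) tr))))

  module Projection (q' : ℕ) (lt : q' < r) where
    q : ℕ
    q = suc q'

    coord : Fin r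
    coord = fromℕ< lt

    pos-coord : pos coord ≡ q
    pos-coord = cong suc (FP.toℕ-fromℕ< lt)

    N : ℕ
    N = m (pos coord) ∸ 1

    ψ : V → Fin (suc N)
    ψ x = clamp N (lookup x coord ∸ 1)

    ψ-resp : ∀ {x y} → lookup x coord ≡ lookup y coord → ψ x ≡ ψ y
    ψ-resp = cong (λ z → clamp N (z ∸ 1))

    ψ-injective : ∀ {x y} → x ∈ XT → y ∈ XT → ψ x ≡ ψ y → lookup x coord ≡ lookup y coord
    ψ-injective x∈X y∈X e with lookup-bounds-X x∈X coord | lookup-bounds-X y∈X coord
    ... | 1≤x , x≤m | 1≤y , y≤m = ∸-cancelʳ-≡ 1≤x 1≤y (clamp-injective (∸-monoˡ-≤ 1 x≤m) (∸-monoˡ-≤ 1 y≤m) e)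

    on-c₁ : ∀ t j → 2 ≤ t → t ≤ r → m t + 1 ≤ j → ψ (u t j) ≡ ψ (v t j) ⊎ ψ (v t j) ≡ ψ (v t (j ∸ 1))
    on-c₁ t j _ _ _ with pos coord <? t
    ... | yes p = inj₁ (ψ-resp {u t j} {v t j} (trans (lookup-u-< t j coord p) (sym (lookup-v-< t j coord p))))
    ... | no p = inj₂ (ψ-resp {v t j} {v t (j ∸ 1)}
                         (trans (lookup-v-≥ t j coord (≮⇒≥ p)) (sym (lookup-v-≥ t (j ∸ 1) coord (≮⇒≥ p)))))

    on-c₂ : ∀ t j → 2 ≤ t → t ≤ r → m t ≤ j → ψ (v t j) ≡ ψ (u t j) ⊎ ψ (u t j) ≡ ψ (u t (j + 1))
    on-c₂ t j _ _ _ with pos coord <? t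
    ... | yes p = inj₁ (ψ-resp {v t j} {u t j} (trans (lookup-v-< t j coord p) (sym (lookup-u-< t j coord p))))
    ... | no p = inj₂ (ψ-resp {u t j} {u t (j + 1)}
                         (trans (lookup-u-≥ t j coord (≮⇒≥ p)) (sym (lookup-u-≥ t (j + 1) coord (≮⇒≥ p)))))

    on-c₃ : ∀ t → 2 ≤ t → t < r → ψ (u t (m t)) ≡ ψ (v t (m t)) ⊎ ψ (v t (m t)) ≡ ψ ones
    on-c₃ t _ _ with pos coord <? t
    ... | yes p = inj₁ (ψ-resp {u t (m t)} {v t (m t)}
                          (trans (lookup-u-< t (m t) coord p) (sym (lookup-v-< t (m t) coord p))))
    ... | no p = inj₂ (ψ-resp {v t (m t)} {ones} (trans (lookup-v-≥ t (m t) coord (≮⇒≥ p)) (sym (lookup-ones coord))))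

    proper : Proper HStar1 ψ
    proper = cEdges-hit ψ on-c₁ on-c₂ on-c₃ , dEdges
      where
      dEdges : ∀ e → DT e → ∃[ x ] ∃[ y ] (x ∈ e × y ∈ e × ¬ (ψ x ≡ ψ y))
      dEdges _ (x , y , x∈X , y∈X , refl , disagree) =
        x , y , here refl , there (here refl) , λ e → disagree coord (ψ-injective x∈X y∈X e)

    coord-onto : ∀ w → 1 ≤ w → w ≤ m (pos coord) → ∃[ x ] (x ∈ XT × lookup x coord ≡ w)
    coord-onto w 1≤w w≤m with w <? m r
    ... | yes w<mr = diag w , diag∈X w 1≤w w<mr , lookup-diag w coord
    ... | no w≮mr = Uℓ w , Uℓ∈X w (≮⇒≥ w≮mr) (≤-trans w≤m (m-pos≤m1 coord)) ,
                    trans (lookup-Uℓ w coord) (m≤n⇒m⊓n≡m w≤m)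

    1+toℕ≤m : ∀ (i : Fin (suc N)) → suc (toℕ i) ≤ m (pos coord)
    1+toℕ≤m i = m≤pred[n]⇒suc[m]≤n {{>-nonZero (2≤⇒1≤ (2≤m-pos coord))}} (≤-pred (FP.toℕ<n i))

    usesAll : UsesAll HStar1 ψ
    usesAll i with coord-onto (suc (toℕ i)) (s≤s z≤n) (1+toℕ≤m i)
    ... | x , x∈X , x≡1+i = x , x∈X , trans (cong (λ z → clamp N (z ∸ 1)) x≡1+i) (clamp-toℕ N i)

    strict : StrictColoring HStar1 (suc N) ψ
    strict = proper , usesAll

    hasShape : HasShape ψ (threshold q (s≤s z≤n) lt)
    hasShape = merged⇔ , joined⇔
      where
      merged⇔ : ∀ j → m r ≤ j → j < m 1 → (ψ (Uℓ j) ≡ ψ (Vℓ j)) ⇔ (j < m q)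
      merged⇔ j lo hi = mk⇔ to from
        where
        to : ψ (Uℓ j) ≡ ψ (Vℓ j) → j < m q
        to e with j <? m (pos coord)
        ... | yes j<m = subst (λ z → j < m z) pos-coord j<m
        ... | no j≮m = ⊥-elim (>⇒≢ (2≤m-pos coord) (begin
            m (pos coord)      ≡⟨ sym (m≥n⇒m⊓n≡n (≮⇒≥ j≮m)) ⟩
            j ⊓ m (pos coord)  ≡⟨ sym (lookup-Uℓ j coord) ⟩
            lookup (Uℓ j) coord ≡⟨ ψ-injective (Uℓ∈X j lo (<⇒≤ hi)) (Vℓ∈X j lo hi) e ⟩
            lookup (Vℓ j) coord ≡⟨ lookup-Vℓ-≥ j coord (≮⇒≥ j≮m) ⟩
            1                  ∎))
          where open ≡-Reasoning
        from : j < m q → ψ (Uℓ j) ≡ ψ (Vℓ j)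
        from j<mq = ψ-resp {Uℓ j} {Vℓ j}
          (trans (lookup-Uℓ j coord) (trans (m≤n⇒m⊓n≡m (<⇒≤ j<m)) (sym (lookup-Vℓ-< j coord j<m))))
          where
          j<m : j < m (pos coord)
          j<m = subst (λ z → j < m z) (sym pos-coord) j<mq
      joined⇔ : (ψ (Vℓ (m r)) ≡ ψ ones) ⇔ (q ≡ r)
      joined⇔ = mk⇔ to from
        where
        to : ψ (Vℓ (m r)) ≡ ψ ones → q ≡ r
        to e with m≤n⇒m<n∨m≡n lt
        ... | inj₂ q≡r = q≡r
        ... | inj₁ q<r = ⊥-elim (>⇒≢ 2≤mr (begin
            m r                      ≡⟨ sym (lookup-Vℓ-< (m r) coord mr<m) ⟩
            lookup (Vℓ (m r)) coord  ≡⟨ ψ-injective (Vℓ∈X (m r) ≤-refl mr<m1) ones∈X e ⟩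
            lookup ones coord        ≡⟨ lookup-ones coord ⟩
            1                        ∎))
          where
          open ≡-Reasoning
          mr<m : m r < m (pos coord)
          mr<m = subst (λ z → m r < m z) (sym pos-coord) (decreasing-< r (s≤s z≤n) q<r ≤-refl)
        from : q ≡ r → ψ (Vℓ (m r)) ≡ ψ ones
        from q≡r = ψ-resp {Vℓ (m r)} {ones}
          (trans (lookup-Vℓ-≥ (m r) coord (≤-reflexive (cong m (trans pos-coord q≡r)))) (sym (lookup-ones coord)))

  -- Colour by the last coordinate, except that the vertices v_r(j) (last coordinate 1,
  -- penultimate ≥ 2) get a colour of their own; only the deleted edge e₂ forbade this.
  module Exceptional where
    val : V → ℕ
    val x = if ⌊ lookup x last ≟ 1 ⌋ then (if ⌊ 2 ≤? lookup x penult ⌋ then m r else 0) else lookup x last ∸ 1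

    ψ : V → Fin (suc (m r))
    ψ x = clamp (m r) (val x)

    val-≢1 : ∀ x → lookup x last ≢ 1 → val x ≡ lookup x last ∸ 1
    val-≢1 x ≢1 = if-false (lookup x last ≟ 1) ≢1

    val-≡1-≥2 : ∀ x → lookup x last ≡ 1 → 2 ≤ lookup x penult → val x ≡ m r
    val-≡1-≥2 x ≡1 ≥2 = trans (if-true (lookup x last ≟ 1) ≡1) (if-true (2 ≤? lookup x penult) ≥2)

    val-≡1-<2 : ∀ x → lookup x last ≡ 1 → ¬ (2 ≤ lookup x penult) → val x ≡ 0
    val-≡1-<2 x ≡1 ≱2 = trans (if-true (lookup x last ≟ 1) ≡1) (if-false (2 ≤? lookup x penult) ≱2)

    val-≡1 : ∀ x → lookup x last ≡ 1 → val x ≡ m r ⊎ val x ≡ 0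
    val-≡1 x ≡1 = by-penult (2 ≤? lookup x penult)
      where
      by-penult : Dec (2 ≤ lookup x penult) → val x ≡ m r ⊎ val x ≡ 0
      by-penult (yes ≥2) = inj₁ (val-≡1-≥2 x ≡1 ≥2)
      by-penult (no ≱2) = inj₂ (val-≡1-<2 x ≡1 ≱2)

    lookup-last-bounds : ∀ {x} → x ∈ XT → 1 ≤ lookup x last × lookup x last ≤ m r
    lookup-last-bounds {x} x∈X with lookup-bounds-X x∈X last
    ... | lower , upper = lower , subst (λ z → lookup x last ≤ m z) pos-last upper

    val-≢1-range : ∀ {x} → x ∈ XT → lookup x last ≢ 1 → 1 ≤ val x × val x < m r
    val-≢1-range {x} x∈X ≢1 rewrite val-≢1 x ≢1 = bounds (lookup x last) (lookup-last-bounds x∈X) ≢1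
      where
      bounds : ∀ a → 1 ≤ a × a ≤ m r → a ≢ 1 → 1 ≤ a ∸ 1 × a ∸ 1 < m r
      bounds (suc zero) _ ≢1 = ⊥-elim (≢1 refl)
      bounds (suc (suc a)) (_ , a≤mr) _ = s≤s z≤n , a≤mr

    val≤ : ∀ {x} → x ∈ XT → val x ≤ m r
    val≤ {x} x∈X = by-last (lookup x last ≟ 1)
      where
      by-last : Dec (lookup x last ≡ 1) → val x ≤ m r
      by-last (no ≢1) = <⇒≤ (proj₂ (val-≢1-range x∈X ≢1))
      by-last (yes ≡1) with val-≡1 x ≡1
      ... | inj₁ val≡mr = ≤-reflexive val≡mr
      ... | inj₂ val≡0 = subst (_≤ m r) (sym val≡0) z≤n

    ψ-injective : ∀ {x y} → x ∈ XT → y ∈ XT → ψ x ≡ ψ y → val x ≡ val y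
    ψ-injective x∈X y∈X = clamp-injective (val≤ x∈X) (val≤ y∈X)

    val≡⇒ψ≡ : ∀ {x y} → val x ≡ val y → ψ x ≡ ψ y
    val≡⇒ψ≡ = cong (clamp (m r))

    ψ-separates : ∀ {x y} → x ∈ XT → y ∈ XT → lookup x last ≢ 1 → lookup y last ≡ 1 → ψ x ≢ ψ y
    ψ-separates {x} {y} x∈X y∈X ≢1 ≡1 e with val-≡1 y ≡1 | val-≢1-range x∈X ≢1 | ψ-injective x∈X y∈X e
    ... | inj₁ val≡mr | _ , val<mr | val≡ = <⇒≢ val<mr (trans val≡ val≡mr)
    ... | inj₂ val≡0 | 1≤val , _ | val≡ = >⇒≢ 1≤val (trans val≡ val≡0)

    val-u : ∀ t j → t ≤ r → val (u t j) ≡ m (pos last) ∸ 1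
    val-u t j tr = trans (val-≢1 (u t j) (λ e → >⇒≢ (2≤m-pos last) (trans (sym (lookup-u-≥ t j last tr')) e)))
                         (cong (_∸ 1) (lookup-u-≥ t j last tr'))
      where tr' = subst (t ≤_) (sym pos-last) tr

    val-v : ∀ t j → t < r → val (v t j) ≡ 0
    val-v t j t<r = val-≡1-<2 (v t j) (lookup-v-≥ t j last (subst (t ≤_) (sym pos-last) (<⇒≤ t<r)))
                      (λ ≥2 → <⇒≱ (s≤s (s≤s z≤n)) (subst (2 ≤_) (lookup-v-≥ t j penult t≤penult) ≥2))
      where t≤penult = subst (t ≤_) (sym pos-penult) (≤-pred t<r)

    val-v-last : ∀ j → 2 ≤ j → val (v r j) ≡ m r
    val-v-last j 2≤j = val-≡1-≥2 (v r j) (lookup-v-≥ r j last (≤-reflexive (sym pos-last)))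
                         (subst (2 ≤_) (sym (lookup-v-< r j penult (subst (_< r) (sym pos-penult) ≤-refl))) 2≤j)

    val-ones : val ones ≡ 0
    val-ones = val-≡1-<2 ones (lookup-ones last)
                 (λ ≥2 → <⇒≱ (s≤s (s≤s z≤n)) (subst (2 ≤_) (lookup-ones penult) ≥2))

    val-Vℓ-mr : val (Vℓ (m r)) ≡ m r
    val-Vℓ-mr = val-≡1-≥2 (Vℓ (m r)) (lookup-Vℓ-≥ (m r) last (≤-reflexive (cong m pos-last)))
                  (subst (2 ≤_) (sym (lookup-Vℓ-< (m r) penult mr<m-penult)) 2≤mr)
      where
      mr<m-penult : m r < m (pos penult)
      mr<m-penult = subst (λ z → m r < m z) (sym pos-penult) (<-trans (n<1+n _) mr+1<m[r-1])

    lookup-Uℓ-last : ∀ j → m r ≤ j → lookup (Uℓ j) last ≡ m r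
    lookup-Uℓ-last j mr≤j = trans (lookup-Uℓ j last) (trans (cong (λ z → j ⊓ m z) pos-last) (m≥n⇒m⊓n≡n mr≤j))

    Uℓ-last≢1 : ∀ j → m r ≤ j → lookup (Uℓ j) last ≢ 1
    Uℓ-last≢1 j mr≤j e = >⇒≢ 2≤mr (trans (sym (lookup-Uℓ-last j mr≤j)) e)

    val-diag : ∀ a → 2 ≤ a → val (diag a) ≡ a ∸ 1
    val-diag a 2≤a = trans (val-≢1 (diag a) (λ e → >⇒≢ 2≤a (trans (sym (lookup-diag a last)) e)))
                           (cong (_∸ 1) (lookup-diag a last))

    on-c₁ : ∀ t j → 2 ≤ t → t ≤ r → m t + 1 ≤ j → ψ (u t j) ≡ ψ (v t j) ⊎ ψ (v t j) ≡ ψ (v t (j ∸ 1))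
    on-c₁ t j 2t tr lo with m≤n⇒m<n∨m≡n tr
    ... | inj₁ t<r = inj₂ (val≡⇒ψ≡ {v t j} {v t (j ∸ 1)} (trans (val-v t j t<r) (sym (val-v t (j ∸ 1) t<r))))
    ... | inj₂ refl =
      inj₂ (val≡⇒ψ≡ {v r j} {v r (j ∸ 1)} (trans (val-v-last j 2≤j) (sym (val-v-last (j ∸ 1) 2≤j∸1))))
      where
      2≤j = ≤-trans 2≤mr (≤-trans (m≤m+n (m r) 1) lo)
      2≤j∸1 = ≤-trans 2≤mr (subst (_≤ j ∸ 1) (m+n∸n≡m (m r) 1) (∸-monoˡ-≤ 1 lo))

    on-c₂ : ∀ t j → 2 ≤ t → t ≤ r → m t ≤ j → ψ (v t j) ≡ ψ (u t j) ⊎ ψ (u t j) ≡ ψ (u t (j + 1))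
    on-c₂ t j 2t tr lo = inj₂ (val≡⇒ψ≡ {u t j} {u t (j + 1)} (trans (val-u t j tr) (sym (val-u t (j + 1) tr))))

    on-c₃ : ∀ t → 2 ≤ t → t < r → ψ (u t (m t)) ≡ ψ (v t (m t)) ⊎ ψ (v t (m t)) ≡ ψ ones
    on-c₃ t 2t t<r = inj₂ (val≡⇒ψ≡ {v t (m t)} {ones} (trans (val-v t (m t) t<r) (sym val-ones)))

    proper : Proper HStar1 ψ
    proper = cEdges-hit ψ on-c₁ on-c₂ on-c₃ , dEdges
      where
      dEdges : ∀ e → DT e → ∃[ x ] ∃[ y ] (x ∈ e × y ∈ e × ¬ (ψ x ≡ ψ y))
      dEdges _ (x , y , x∈X , y∈X , refl , disagree) = x , y , here refl , there (here refl) , separated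
        where
        separated : ψ x ≢ ψ y
        separated e = by-last (lookup x last ≟ 1) (lookup y last ≟ 1)
          where
          by-last : Dec (lookup x last ≡ 1) → Dec (lookup y last ≡ 1) → ⊥
          by-last (yes x≡1) (yes y≡1) = disagree last (trans x≡1 (sym y≡1))
          by-last (no x≢1) (yes y≡1) = ψ-separates x∈X y∈X x≢1 y≡1 e
          by-last (yes x≡1) (no y≢1) = ψ-separates y∈X x∈X y≢1 x≡1 (sym e)
          by-last (no x≢1) (no y≢1) =
            disagree last (∸-cancelʳ-≡ (proj₁ (lookup-last-bounds x∈X)) (proj₁ (lookup-last-bounds y∈X))
                            (trans (sym (val-≢1 x x≢1)) (trans (ψ-injective x∈X y∈X e) (val-≢1 y y≢1))))

    val-onto : ∀ w → w ≤ m r → ∃[ x ] (x ∈ XT × val x ≡ w)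
    val-onto zero _ = ones , ones∈X , val-ones
    val-onto (suc w) 1+w≤mr with suc w ≟ m r | suc (suc w) <? m r
    ... | yes 1+w≡mr | _ = Vℓ (m r) , Vℓ∈X (m r) ≤-refl mr<m1 , trans val-Vℓ-mr (sym 1+w≡mr)
    ... | no _ | yes 2+w<mr = diag (suc (suc w)) , diag∈X _ (s≤s z≤n) 2+w<mr , val-diag _ (s≤s (s≤s z≤n))
    ... | no 1+w≢mr | no 2+w≮mr = Uℓ (m r) , Uℓ∈X (m r) ≤-refl (<⇒≤ mr<m1) ,
                                   trans (val-≢1 (Uℓ (m r)) (Uℓ-last≢1 (m r) ≤-refl))
                                         (cong (_∸ 1) (trans (lookup-Uℓ-last (m r) ≤-refl) mr≡2+w))
      where
      mr≡2+w : m r ≡ suc (suc w)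
      mr≡2+w = ≤-antisym (≮⇒≥ 2+w≮mr) (≤∧≢⇒< 1+w≤mr 1+w≢mr)

    usesAll : UsesAll HStar1 ψ
    usesAll i with val-onto (toℕ i) (≤-pred (FP.toℕ<n i))
    ... | x , x∈X , val≡ = x , x∈X , trans (cong (clamp (m r)) val≡) (clamp-toℕ (m r) i)

    strict : StrictColoring HStar1 (suc (m r)) ψ
    strict = proper , usesAll

    hasShape : HasShape ψ exceptional
    hasShape = (λ j lo hi → mk⇔ (ψ-separates (Uℓ∈X j lo (<⇒≤ hi)) (Vℓ∈X j lo hi) (Uℓ-last≢1 j lo)
                                              (lookup-Vℓ-≥ j last (subst (λ z → m z ≤ j) (sym pos-last) lo)))
                                ⊥-elim) ,
               mk⇔ Vℓ-mr≢ones ⊥-elim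
      where
      Vℓ-mr≢ones : ψ (Vℓ (m r)) ≢ ψ ones
      Vℓ-mr≢ones e = <⇒≢ (2≤⇒1≤ 2≤mr)
        (sym (trans (sym val-Vℓ-mr) (trans (ψ-injective (Vℓ∈X (m r) ≤-refl mr<m1) ones∈X e) val-ones)))

  Canonical : Shape → Set
  Canonical τ = Σ (V → Fin (colours τ)) (λ ψ → StrictColoring HStar1 (colours τ) ψ × HasShape ψ τ)

  canonical : (τ : Shape) → Canonical τ
  canonical (threshold (suc q') (s≤s z≤n) q≤r) =
    subst (λ N → Σ (V → Fin N) (λ ψ → StrictColoring HStar1 N ψ × HasShape ψ (threshold (suc q') (s≤s z≤n) q≤r)))
          (trans (suc-pred (m (pos P.coord)) {{>-nonZero (2≤⇒1≤ (2≤m-pos P.coord))}}) (cong m P.pos-coord))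
          (P.ψ , P.strict , P.hasShape)
    where
    module P = Projection q' q≤r
  canonical exceptional = Exceptional.ψ , Exceptional.strict , Exceptional.hasShape

  Spectrum : ℕ → Set
  Spectrum k = Σ Shape (λ τ → colours τ ≡ k)

  -- m_r + 1 < m_{r-1} is what makes the exceptional number of colours differ from every m_q.
  threshold≢1+mr : ∀ q → 1 ≤ q → q ≤ r → m q ≢ suc (m r)
  threshold≢1+mr q 1≤q q≤r with m≤n⇒m<n∨m≡n q≤r
  ... | inj₂ refl = <⇒≢ (n<1+n (m r))
  ... | inj₁ q<r = ≢-sym (<⇒≢ (<-≤-trans mr+1<m[r-1] (decreasing-≤ (suc r') 1≤q (≤-pred q<r) (n≤1+n _))))

  colours-injective : ∀ {τ τ'} → colours τ ≡ colours τ' → τ ≡ τ'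
  colours-injective {threshold q 1≤q q≤r} {threshold q' 1≤q' q'≤r} e with decreasing-injective 1≤q 1≤q' q≤r q'≤r e
  ... | refl = cong₂ (threshold q) (≤-irrelevant 1≤q 1≤q') (≤-irrelevant q≤r q'≤r)
  colours-injective {threshold q 1≤q q≤r} {exceptional} e = ⊥-elim (threshold≢1+mr q 1≤q q≤r e)
  colours-injective {exceptional} {threshold q 1≤q q≤r} e = ⊥-elim (threshold≢1+mr q 1≤q q≤r (sym e))
  colours-injective {exceptional} {exceptional} e = refl

  shape-colours : ∀ {k} (c : V → Fin k) (pc : Proper HStar1 c) → UsesAll HStar1 c →
                  colours (proj₁ (Classify.shapeOf c pc)) ≡ k
  shape-colours c pc usesAll with Classify.shapeOf c pc
  ... | τ , c-shape with canonical τ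
  ...   | ψ , (ψ-proper , ψ-usesAll) , ψ-shape =
    sym (colours-unique HStar1 c ψ usesAll ψ-usesAll
           (same-shape⇒kernel⊆ c ψ pc ψ-proper c-shape ψ-shape) (same-shape⇒kernel⊆ ψ c ψ-proper pc ψ-shape c-shape))

  feasible⇒spectrum : ∀ k → Feasible HStar1 k → Spectrum k
  feasible⇒spectrum k (c , pc , usesAll) = proj₁ (Classify.shapeOf c pc) , shape-colours c pc usesAll

  spectrum⇒feasible : ∀ k → Spectrum k → Feasible HStar1 k
  spectrum⇒feasible k (τ , refl) = proj₁ (canonical τ) , proj₁ (proj₂ (canonical τ))

  strict⇒samePartition : ∀ {k} (c c' : V → Fin k) → StrictColoring HStar1 k c → StrictColoring HStar1 k c' →
                         SamePartition HStar1 c c'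
  strict⇒samePartition c c' (pc , usesAll) (pc' , usesAll') x y x∈X y∈X =
    mk⇔ (same-shape⇒kernel⊆ c c' pc pc' c-shape c'-shape x y x∈X y∈X)
        (same-shape⇒kernel⊆ c' c pc' pc c'-shape c-shape x y x∈X y∈X)
    where
    c-shape = proj₂ (Classify.shapeOf c pc)
    τ≡τ' = colours-injective (trans (shape-colours c pc usesAll) (sym (shape-colours c' pc' usesAll')))
    c'-shape = subst (HasShape c') (sym τ≡τ') (proj₂ (Classify.shapeOf c' pc'))

  oneRealization : OneRealization HStar1 Spectrum
  oneRealization = (λ k → mk⇔ (feasible⇒spectrum k) (spectrum⇒feasible k)) ,
                   (λ k sk → spectrum⇒feasible k sk , strict⇒samePartition)

module Reduction (s' : ℕ) (n : ℕ → ℕ)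
  (n-decreasing : ∀ i → 1 ≤ i → i < suc (suc (suc s')) → n (suc i) < n i)
  (2≤n-last : 2 ≤ n (suc (suc (suc s'))))
  (n-last+1∈S : InS (suc (suc (suc s'))) n (suc (n (suc (suc (suc s'))))))
  where

  s : ℕ
  s = suc (suc (suc s'))

  T : ℕ → ℕ
  T = Tseq s n

  open Decreasing n s n-decreasing using (decreasing-<)

  T-≤ : ∀ p → p ≤ suc s' → T p ≡ n p
  T-≤ p le = if-true (p ≤? suc s') le

  T-> : ∀ p → ¬ p ≤ suc s' → T p ≡ n s
  T-> p nle = if-false (p ≤? suc s') nle

  n-last<n : ∀ p → 1 ≤ p → p < s → n s < n p
  n-last<n p 1≤p p<s = decreasing-< s 1≤p p<s ≤-refl

  T-decreasing : ∀ p → 1 ≤ p → p < suc (suc s') → T (suc p) < T p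
  T-decreasing p 1≤p p<r = step (suc p ≤? suc s')
    where
    step : Dec (suc p ≤ suc s') → T (suc p) < T p
    step (yes le) = subst₂ _<_ (sym (T-≤ (suc p) le)) (sym (T-≤ p (≤-pred p<r)))
                      (n-decreasing p 1≤p (<-trans p<r (n<1+n _)))
    step (no nle) = subst₂ _<_ (sym (T-> (suc p) nle)) (sym (T-≤ p (≤-pred p<r)))
                      (n-last<n p 1≤p (<-trans p<r (n<1+n _)))

  2≤T-last : 2 ≤ T (suc (suc s'))
  2≤T-last = subst (2 ≤_) (sym (T-> _ 1+n≰n)) 2≤n-last

  T-gap : suc (T (suc (suc s'))) < T (suc s')
  T-gap = subst₂ (λ a b → suc a < b) (sym (T-> _ 1+n≰n)) (sym (T-≤ (suc s') ≤-refl))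
            (≤-<-trans (n-last<n (suc (suc s')) (s≤s z≤n) ≤-refl)
                       (n-decreasing (suc s') (s≤s z≤n) (n≤1+n _)))

  n-penult≡n-last+1 : n (suc (suc s')) ≡ suc (n s)
  n-penult≡n-last+1 = penult n-last+1∈S
    where
    penult : InS s n (suc (n s)) → n (suc (suc s')) ≡ suc (n s)
    penult (i , 1≤i , i≤s , nᵢ≡) with i ≤? suc s' | i ≟ s
    ... | yes i≤s-2 | _ = ⊥-elim (<⇒≢ (≤-<-trans (n-last<n (suc (suc s')) (s≤s z≤n) ≤-refl)
                                     (decreasing-< (suc (suc s')) 1≤i (s≤s i≤s-2) (n≤1+n _))) (sym nᵢ≡))
    ... | no _ | yes refl = ⊥-elim (<⇒≢ (n<1+n (n s)) nᵢ≡)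
    ... | no i≰s-2 | no i≢s with ≤-antisym (≤-pred (≤∧≢⇒< i≤s i≢s)) (≰⇒> i≰s-2)
    ...   | refl = nᵢ≡

  module K = StarOne s' T T-decreasing 2≤T-last T-gap

  T∈S : ∀ q → 1 ≤ q → q ≤ suc (suc s') → InS s n (T q)
  T∈S q 1≤q q≤r = by-position (q ≤? suc s')
    where
    by-position : Dec (q ≤ suc s') → InS s n (T q)
    by-position (yes le) = q , 1≤q , ≤-trans q≤r (n≤1+n _) , sym (T-≤ q le)
    by-position (no nle) = s , s≤s z≤n , ≤-refl , sym (T-> q nle)

  S⊆spectrum : ∀ i → 1 ≤ i → i ≤ s → K.Spectrum (n i)
  S⊆spectrum i 1≤i i≤s with i ≤? suc s' | i ≟ s
  ... | yes le | _ = K.threshold i 1≤i (≤-trans le (n≤1+n _)) , T-≤ i le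
  ... | no _ | yes refl = K.threshold (suc (suc s')) (s≤s z≤n) ≤-refl , T-> _ 1+n≰n
  ... | no i≰s-2 | no i≢s with ≤-antisym (≤-pred (≤∧≢⇒< i≤s i≢s)) (≰⇒> i≰s-2)
  ...   | refl = K.exceptional , trans (cong suc (T-> _ 1+n≰n)) (sym n-penult≡n-last+1)

  spectrum⇔S : ∀ k → K.Spectrum k ⇔ InS s n k
  spectrum⇔S k = mk⇔ to from
    where
    to : K.Spectrum k → InS s n k
    to (K.threshold q 1≤q q≤r , Tq≡k) = subst (InS s n) Tq≡k (T∈S q 1≤q q≤r)
    to (K.exceptional , 1+T≡k) =
      suc (suc s') , s≤s z≤n , n≤1+n _ , trans n-penult≡n-last+1 (trans (cong suc (sym (T-> _ 1+n≰n))) 1+T≡k)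
    from : InS s n k → K.Spectrum k
    from (i , 1≤i , i≤s , nᵢ≡k) = subst K.Spectrum nᵢ≡k (S⊆spectrum i 1≤i i≤s)

  oneRealization : OneRealization (H⋆¹ s n) (InS s n)
  oneRealization = OneRealization-resp (H⋆¹ s n) spectrum⇔S K.oneRealization

n₁+1∉S-singleton : ∀ n → ¬ InS 1 n (suc (n 1))
n₁+1∉S-singleton n (i , 1≤i , i≤1 , nᵢ≡) with ≤-antisym i≤1 1≤i
... | refl = <⇒≢ (n<1+n (n 1)) nᵢ≡

n₂+1∉S-pair : ∀ n → ¬ InS 2 n (n 1 ∸ 1) → ¬ InS 2 n (suc (n 2))
n₂+1∉S-pair n n₁∸1∉S (suc zero , _ , _ , n₁≡) = n₁∸1∉S (2 , s≤s z≤n , ≤-refl , sym (cong (_∸ 1) n₁≡))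
n₂+1∉S-pair n n₁∸1∉S (suc (suc zero) , _ , _ , n₂≡) = <⇒≢ (n<1+n (n 2)) n₂≡
n₂+1∉S-pair n n₁∸1∉S (suc (suc (suc _)) , _ , s≤s (s≤s ()) , _)

theorem3p6 : (s : ℕ) (n : ℕ → ℕ) →
    1 ≤ s →
    (∀ i → 1 ≤ i → i < s → n (suc i) < n i) →
    2 ≤ n s →
    ¬ InS s n (n 1 ∸ 1) →
    InS s n (suc (n s)) →
    OneRealization (H⋆¹ s n) (InS s n)
theorem3p6 zero n () _ _ _ _
theorem3p6 (suc zero) n _ _ _ _ n₁+1∈S = ⊥-elim (n₁+1∉S-singleton n n₁+1∈S)
theorem3p6 (suc (suc zero)) n _ _ _ n₁∸1∉S n₂+1∈S = ⊥-elim (n₂+1∉S-pair n n₁∸1∉S n₂+1∈S)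
theorem3p6 (suc (suc (suc s'))) n _ n-decreasing 2≤nₛ _ nₛ+1∈S =
  Reduction.oneRealization s' n n-decreasing 2≤nₛ nₛ+1∈S
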